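{- (i) Let $(\lambda x.M)N\in\Lambda_{\circledR}$. If $\Gamma\vdash M\langle N/x\rangle:\sigma$ and $N$ is typeable in $\lambda_{\circledR}\cap$, then $\Gamma\vdash(\lambda x.M)N:\sigma$. (ii) Let $M\in\Lambda_{\circledR}$ be a redex of one of the non-$\beta$ reduction rules and let $M\to M'$ by that rule. If $\Gamma\vdash M':\sigma$, then $\Gamma\vdash M:\sigma$.
   Context: Terms. Fix a countably infinite set of variables. The set $\Lambda_{\circledR}$ of terms and $Fv(M)$ are defined simultaneously: every variable $x$ is a term with $Fv(x)=\{x\}$; $\lambda x.M$ is a term if $M$ is a term and $x\in Fv(M)$ ($Fv=Fv(M)\setminus\{x\}$); $MN$ is a term if $M,N$ are terms with $Fv(M)\cap Fv(N)=\emptyset$ ($Fv=Fv(M)\cup Fv(N)$); $x\odot M$ (erasure) is a term if $M$ is a term and $x\notin Fv(M)$ ($Fv=\{x\}\cup Fv(M)$); $x<^{x_1}_{x_2}M$ (duplication) is a term if $M$ is a term, $x_1,x_2\in Fv(M)$, $x_1\neq x_2$, $x\notin Fv(M)\setminus\{x_1,x_2\}$ ($Fv=\{x\}\cup(Fv(M)\setminus\{x_1,x_2\})$). $\alpha$-conversion and Barendregt's convention assumed; $Fv[M]$ is the ordered list of free variables; $X\odot M$, $X<^{Y}_{Z}M$ are iterated erasures/duplications over lists. Substitution. $M\langle N/x\rangle$ is the unique normal form, in $\Lambda_{\circledR}$, of $M[N/x]$ under: $x[N/x]\to N$; $(\lambda y.M)[N/x]\to\lambda y.M[N/x]$ ($y\ne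 x$); $(MP)[N/x]\to M[N/x]P$ if $x\in Fv(M)$; $(MP)[N/x]\to M\,P[N/x]$ if $x\in Fv(P)$; $(y\odot M)[N/x]\to y\odot M[N/x]$ ($y\neq x$); $(x\odot M)[N/x]\to Fv(N)\odot M$; $(y<^{y_1}_{y_2}M)[N/x]\to y<^{y_1}_{y_2}M[N/x]$ ($y\ne x$); $(x<^{x_1}_{x_2}M)[N/x]\to Fv[N]<^{Fv[N_1]}_{Fv[N_2]}M[N_1/x_1][N_2/x_2]$ ($N_1,N_2$ fresh renamings of $N$). Reduction rules: ($\beta$) $(\lambda x.M)N\to M\langle N/x\rangle$; non-$\beta$ rules: $x<^{x_1}_{x_2}(\lambda y.M)\to\lambda y.x<^{x_1}_{x_2}M$; $x<^{x_1}_{x_2}(MN)\to(x<^{x_1}_{x_2}M)N$ if $x_1,x_2\notin Fv(N)$; $x<^{x_1}_{x_2}(MN)\to M(x<^{x_1}_{x_2}N)$ if $x_1,x_2\notin Fv(M)$; $\lambda x.(y\odot M)\to y\odot(\lambda x.M)$ ($x\neq y$); $(x\odot M)N\to x\odot(MN)$; $M(x\odot N)\to x\odot(MN)$; $x<^{x_1}_{x_2}(y\odot M)\to y\odot(x<^{x_1}_{x_2}M)$ ($y\ne x_1,x_2$); $x<^{x_1}_{x_2}(x_1\odot M)\to M\langle x/x_2\rangle$. Types. Strict types $\sigma::=p\mid\alpha\to\sigma$; types $\alpha::=\cap_{i=1}^n\sigma_i$ ($=\top$ if $n=0$), with $\cap$ commutative, associative, $\top$ neutral. A basis $\Gamma$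 maps a finite set $Dom(\Gamma)$ of variables to types; $\Gamma,x:\alpha$ extends by $x\notin Dom(\Gamma)$; for $Dom(\Gamma)=Dom(\Delta)$, $(\Gamma\sqcap\Delta)(x)=\Gamma(x)\cap\Delta(x)$; $\Gamma^{\top}$ maps $Dom(\Gamma)$ to $\top$. Rules of $\lambda_{\circledR}\cap$: (Ax) $x:\sigma\vdash x:\sigma$; ($\to_I$) from $\Gamma,x:\alpha\vdash M:\sigma$ infer $\Gamma\vdash\lambda x.M:\alpha\to\sigma$; ($\to_E$) from $\Gamma\vdash M:\cap_{i=1}^n\tau_i\to\sigma$ and $\Delta_0\vdash N:\tau_0,\dots,\Delta_n\vdash N:\tau_n$ infer $\Gamma,\Delta_0^{\top}\sqcap\Delta_1\sqcap\dots\sqcap\Delta_n\vdash MN:\sigma$; (Cont) from $\Gamma,x:\alpha,y:\beta\vdash M:\sigma$ infer $\Gamma,z:\alpha\cap\beta\vdash z<^{x}_{y}M:\sigma$; (Thin) from $\Gamma\vdash M:\sigma$ infer $\Gamma,x:\top\vdash x\odot M:\sigma$. A term $N$ is typeable if $\Delta\vdash N:\tau$ for some $\Delta,\tau$. -}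

module Defs where

open import Data.Nat using (ℕ; _≟_)
open import Data.List using (List; []; _∷_; _++_; map)
open import Data.List.Membership.Propositional using (_∈_; _∉_)
open import Data.Maybe using (Maybe; just; nothing)
open import Data.Maybe.Relation.Binary.Pointwise using (Pointwise)
open import Data.Product using (Σ; _×_; _,_; ∃)
open import Data.Sum using (_⊎_)
open import Relation.Nullary using (¬_; yes; no)
open import Relation.Binary.PropositionalEquality using (_≡_; _≢_)
open import Function.Definitions using (Injective)

Var : Set
Var = ℕ

infixl 7 _·_
data Term : Set where
  `_   : Var → Term
  ƛ_⇒_ : Var → Term → Term
  _·_  : Term → Term → Term
  _⊙_  : Var → Term → Term
  dup  : Var → Var → Var → Term → Term  -- dup x x₁ x₂ M = x <^{x₁}_{x₂} M  (duplication)

remove : Var → List Var → List Var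
remove x [] = []
remove x (y ∷ ys) with y ≟ x
... | yes _ = remove x ys
... | no  _ = y ∷ remove x ys

fv : Term → List Var
fv (` x) = x ∷ []
fv (ƛ x ⇒ M) = remove x (fv M)
fv (M · N) = fv M ++ fv N
fv (x ⊙ M) = x ∷ fv M
fv (dup x x₁ x₂ M) = x ∷ remove x₁ (remove x₂ (fv M))

vars : Term → List Var
vars (` x) = x ∷ []
vars (ƛ x ⇒ M) = x ∷ vars M
vars (M · N) = vars M ++ vars N
vars (x ⊙ M) = x ∷ vars M
vars (dup x x₁ x₂ M) = x ∷ x₁ ∷ x₂ ∷ vars M

Disjoint : List Var → List Var → Set
Disjoint xs ys = ∀ {v} → v ∈ xs → v ∉ ys

data WF : Term → Set where
  wf-var : ∀ {x} → WF (` x)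
  wf-abs : ∀ {x M} → WF M → x ∈ fv M → WF (ƛ x ⇒ M)
  wf-app : ∀ {M N} → WF M → WF N → Disjoint (fv M) (fv N) → WF (M · N)
  wf-era : ∀ {x M} → WF M → x ∉ fv M → WF (x ⊙ M)
  wf-dup : ∀ {x x₁ x₂ M} → WF M → x₁ ∈ fv M → x₂ ∈ fv M → x₁ ≢ x₂ →
           x ∉ remove x₁ (remove x₂ (fv M)) → WF (dup x x₁ x₂ M)

erasures : List Var → Term → Term
erasures [] M = M
erasures (x ∷ xs) M = x ⊙ erasures xs M

dups : List Var → List Var → List Var → Term → Term
dups (x ∷ xs) (y ∷ ys) (z ∷ zs) M = dup x y z (dups xs ys zs M)
dups _ _ _ M = M

-- renaming of every variable occurrence (used with an injective f whose
-- image is fresh: this yields a fresh renaming of a term)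
ren : (Var → Var) → Term → Term
ren f (` x) = ` f x
ren f (ƛ x ⇒ M) = ƛ f x ⇒ ren f M
ren f (M · N) = ren f M · ren f N
ren f (x ⊙ M) = f x ⊙ ren f M
ren f (dup x x₁ x₂ M) = dup (f x) (f x₁) (f x₂) (ren f M)

FreshPair : (Var → Var) → (Var → Var) → List Var → Set
FreshPair f g avoid =
  Injective _≡_ _≡_ f × Injective _≡_ _≡_ g ×
  (∀ v → f v ∉ avoid) × (∀ v → g v ∉ avoid) × (∀ v w → f v ≢ g w)

-- Substitution:  Subst M N x R  means  R = M⟨N/x⟩, i.e. R is the normal
-- form of M[N/x] under the rewriting rules of the paper.  Side conditions
-- on bound variables express Barendregt's convention (bound names are
-- distinct from x and from the free variables of N).

data Subst : Term → Term → Var → Term → Set where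
  s-var  : ∀ {x N} → Subst (` x) N x N
  s-abs  : ∀ {y M N x R} → y ≢ x → y ∉ fv N →
           Subst M N x R → Subst (ƛ y ⇒ M) N x (ƛ y ⇒ R)
  s-appL : ∀ {M P N x R} → x ∈ fv M →
           Subst M N x R → Subst (M · P) N x (R · P)
  s-appR : ∀ {M P N x R} → x ∈ fv P →
           Subst P N x R → Subst (M · P) N x (M · R)
  s-era  : ∀ {y M N x R} → y ≢ x →
           Subst M N x R → Subst (y ⊙ M) N x (y ⊙ R)
  s-era≡ : ∀ {M N x} → Subst (x ⊙ M) N x (erasures (fv N) M)
  s-dup  : ∀ {y y₁ y₂ M N x R} → y ≢ x → y₁ ≢ x → y₂ ≢ x →
           y₁ ∉ fv N → y₂ ∉ fv N →
           Subst M N x R → Subst (dup y y₁ y₂ M) N x (dup y y₁ y₂ R)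
  s-dup≡ : ∀ {x₁ x₂ M N x R₁ R} (f g : Var → Var) →
           FreshPair f g (vars (dup x x₁ x₂ M) ++ vars N) →
           Subst M (ren f N) x₁ R₁ → Subst R₁ (ren g N) x₂ R →
           Subst (dup x x₁ x₂ M) N x
                 (dups (fv N) (fv (ren f N)) (fv (ren g N)) R)

-- Non-β reduction rules (applied at the root of the redex)

data NonBeta : Term → Term → Set where
  γ-abs  : ∀ {x x₁ x₂ y M} → y ≢ x →
           NonBeta (dup x x₁ x₂ (ƛ y ⇒ M)) (ƛ y ⇒ dup x x₁ x₂ M)
  γ-appL : ∀ {x x₁ x₂ M N} → x₁ ∉ fv N → x₂ ∉ fv N →
           NonBeta (dup x x₁ x₂ (M · N)) (dup x x₁ x₂ M · N)
  γ-appR : ∀ {x x₁ x₂ M N} → x₁ ∉ fv M → x₂ ∉ fv M →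
           NonBeta (dup x x₁ x₂ (M · N)) (M · dup x x₁ x₂ N)
  ω-abs  : ∀ {x y M} → x ≢ y →
           NonBeta (ƛ x ⇒ (y ⊙ M)) (y ⊙ (ƛ x ⇒ M))
  ω-appL : ∀ {x M N} → NonBeta ((x ⊙ M) · N) (x ⊙ (M · N))
  ω-appR : ∀ {x M N} → NonBeta (M · (x ⊙ N)) (x ⊙ (M · N))
  γω     : ∀ {x x₁ x₂ y M} → y ≢ x₁ → y ≢ x₂ →
           NonBeta (dup x x₁ x₂ (y ⊙ M)) (y ⊙ dup x x₁ x₂ M)
  γω≡    : ∀ {x x₁ x₂ M R} → Subst M (` x) x₂ R →
           NonBeta (dup x x₁ x₂ (x₁ ⊙ M)) R

-- Strict types σ ::= p | α → σ ;  α = ∩ of a list of strict types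
-- (the empty list is ⊤).  Lists give associativity and neutrality of ⊤;
-- commutativity is imposed by the congruence ≈ below.

mutual
  data Strict : Set where
    atom : ℕ → Strict
    _⇒_  : Inter → Strict → Strict

  Inter : Set
  Inter = List Strict

infixr 5 _⇒_

mutual
  data _≈ˢ_ : Strict → Strict → Set where
    ≈-atom  : ∀ {p} → atom p ≈ˢ atom p
    ≈-arr   : ∀ {α β σ τ} → α ≈ᵢ β → σ ≈ˢ τ → (α ⇒ σ) ≈ˢ (β ⇒ τ)
    ≈ˢ-sym  : ∀ {σ τ} → σ ≈ˢ τ → τ ≈ˢ σ
    ≈ˢ-trans : ∀ {σ τ ρ} → σ ≈ˢ τ → τ ≈ˢ ρ → σ ≈ˢ ρ

  data _≈ᵢ_ : Inter → Inter → Set where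
    ≈-[]    : [] ≈ᵢ []
    ≈-∷     : ∀ {σ τ α β} → σ ≈ˢ τ → α ≈ᵢ β → (σ ∷ α) ≈ᵢ (τ ∷ β)
    ≈-swap  : ∀ {σ τ α} → (σ ∷ τ ∷ α) ≈ᵢ (τ ∷ σ ∷ α)
    ≈ᵢ-sym  : ∀ {α β} → α ≈ᵢ β → β ≈ᵢ α
    ≈ᵢ-trans : ∀ {α β γ} → α ≈ᵢ β → β ≈ᵢ γ → α ≈ᵢ γ

Basis : Set
Basis = Var → Maybe Inter

_≈ᶜ_ : Basis → Basis → Set
Γ ≈ᶜ Δ = ∀ x → Pointwise _≈ᵢ_ (Γ x) (Δ x)

∅ : Basis
∅ _ = nothing

-- Γ , x : α   (used only when x ∉ Dom Γ)
_,_∶_ : Basis → Var → Inter → Basis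
(Γ , x ∶ α) y with y ≟ x
... | yes _ = just α
... | no  _ = Γ y

-- Γ , Δ  for disjoint domains
_⊎ᶜ_ : Basis → Basis → Basis
(Γ ⊎ᶜ Δ) y with Γ y
... | just α  = just α
... | nothing = Δ y

DisjointDom : Basis → Basis → Set
DisjointDom Γ Δ = ∀ x → Γ x ≡ nothing ⊎ Δ x ≡ nothing

SameDom : Basis → Basis → Set
SameDom Γ Δ = ∀ x → (Γ x ≡ nothing → Δ x ≡ nothing) × (Δ x ≡ nothing → Γ x ≡ nothing)

-- Γ ⊓ Δ  (pointwise intersection, for equal domains)
_⊓_ : Basis → Basis → Basis
(Γ ⊓ Δ) y with Γ y | Δ y
... | just α | just β = just (α ++ β)
... | _      | _      = nothing

_ᵀ : Basis → Basis
(Γ ᵀ) y with Γ y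
... | just _  = just []
... | nothing = nothing

-- Typing rules of λ_®∩.  Since types and bases are taken modulo ≈,
-- a conversion rule (≈) makes the judgement invariant under ≈.

infix 4 _⊢_∶_ _⊢*_∶_

mutual
  data _⊢_∶_ : Basis → Term → Strict → Set where
    Ax    : ∀ {x σ} → (∅ , x ∶ (σ ∷ [])) ⊢ ` x ∶ σ
    →I    : ∀ {Γ x α M σ} → Γ x ≡ nothing →
            (Γ , x ∶ α) ⊢ M ∶ σ → Γ ⊢ ƛ x ⇒ M ∶ (α ⇒ σ)
    →E    : ∀ {Γ Δ M N τs σ} → Γ ⊢ M ∶ (τs ⇒ σ) → Δ ⊢* N ∶ τs →
            DisjointDom Γ Δ → (Γ ⊎ᶜ Δ) ⊢ M · N ∶ σ
    Cont  : ∀ {Γ x y z α β M σ} → Γ x ≡ nothing → (Γ , x ∶ α) y ≡ nothing →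
            Γ z ≡ nothing →
            ((Γ , x ∶ α) , y ∶ β) ⊢ M ∶ σ →
            (Γ , z ∶ (α ++ β)) ⊢ dup z x y M ∶ σ
    Thin  : ∀ {Γ x M σ} → Γ x ≡ nothing → Γ ⊢ M ∶ σ →
            (Γ , x ∶ []) ⊢ x ⊙ M ∶ σ
    Conv  : ∀ {Γ Γ' M σ σ'} → Γ ⊢ M ∶ σ → Γ ≈ᶜ Γ' → σ ≈ˢ σ' → Γ' ⊢ M ∶ σ'

  -- premises Δ₀ ⊢ N : τ₀ , Δ₁ ⊢ N : τ₁ , … , Δₙ ⊢ N : τₙ of (→E),
  -- collected into the basis  Δ₀^⊤ ⊓ Δ₁ ⊓ … ⊓ Δₙ
  data _⊢*_∶_ : Basis → Term → Inter → Set where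
    arg₀ : ∀ {Δ₀ N τ₀} → Δ₀ ⊢ N ∶ τ₀ → (Δ₀ ᵀ) ⊢* N ∶ []
    arg+ : ∀ {Δᵢ Δ N τ τs} → Δᵢ ⊢ N ∶ τ → Δ ⊢* N ∶ τs → SameDom Δᵢ Δ →
           (Δᵢ ⊓ Δ) ⊢* N ∶ (τ ∷ τs)

Typeable : Term → Set
Typeable N = Σ Basis λ Δ → Σ Strict λ τ → Δ ⊢ N ∶ τ

module Submission where

-- Part (ii) is then a
-- rule-by-rule rearrangement of inverted derivations.
--
-- Part (i) rests on an expansion lemma, proved by induction on the
-- substitution relation: a typing of M⟨N/x⟩ splits into a typing of M with
-- x : α and typings of N against every component of α, which are exactly
-- the premises of (→E) for (λx.M) N.  Its proof needs that substitution
-- preserves linearity of variable use, that typing is stable under the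
-- fresh renamings performed at duplications, and inversion of iterated
-- erasures and duplications.  The rule γω≡ of part (ii) is the instance of
-- the expansion lemma with a variable as argument.

open import Defs
open import Data.Nat using (_≟_)
open import Data.List using (List; []; _∷_; _++_; map)
open import Data.List.Properties using (++-assoc; ++-identityʳ; map-++)
open import Data.List.Membership.Propositional using (_∈_; _∉_)
open import Data.List.Membership.Propositional.Properties using (∈-++⁺ʳ; ∈-++⁺ˡ; ∈-++⁻; ∈-map⁺; ∈-map⁻)
open import Data.List.Membership.DecPropositional _≟_ using (_∈?_)
open import Data.List.Relation.Unary.Any using (here; there)
open import Data.Maybe using (Maybe; just; nothing)
open import Data.Maybe.Relation.Binary.Pointwise as Pointwise using (Pointwise; just; nothing)
open import Data.Product using (_,_; _×_; proj₁; proj₂; Σ; ∃)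
open import Data.Sum using (_⊎_; inj₁; inj₂; [_,_]′)
open import Data.Unit using (⊤; tt)
open import Data.Empty using (⊥; ⊥-elim)
open import Function.Definitions using (Injective)
open import Relation.Nullary using (no; yes)
open import Relation.Binary.PropositionalEquality using (_≡_; _≢_; refl; sym; trans; subst; cong; cong₂; ≢-sym)

mutual
  ≈ˢ-refl : ∀ σ → σ ≈ˢ σ
  ≈ˢ-refl (atom p) = ≈-atom
  ≈ˢ-refl (α ⇒ σ) = ≈-arr (≈ᵢ-refl α) (≈ˢ-refl σ)

  ≈ᵢ-refl : ∀ α → α ≈ᵢ α
  ≈ᵢ-refl [] = ≈-[]
  ≈ᵢ-refl (σ ∷ α) = ≈-∷ (≈ˢ-refl σ) (≈ᵢ-refl α)

≡⇒≈ᵢ : ∀ {α β} → α ≡ β → α ≈ᵢ β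
≡⇒≈ᵢ {α} refl = ≈ᵢ-refl α

++-congʳ : ∀ α {β β'} → β ≈ᵢ β' → (α ++ β) ≈ᵢ (α ++ β')
++-congʳ [] p = p
++-congʳ (σ ∷ α) p = ≈-∷ (≈ˢ-refl σ) (++-congʳ α p)

++-cong : ∀ {α α' β β'} → α ≈ᵢ α' → β ≈ᵢ β' → (α ++ β) ≈ᵢ (α' ++ β')
++-cong ≈-[] q = q
++-cong (≈-∷ s p) q = ≈-∷ s (++-cong p q)
++-cong {σ ∷ τ ∷ α} ≈-swap q = ≈ᵢ-trans ≈-swap (++-congʳ (τ ∷ σ ∷ α) q)
++-cong (≈ᵢ-sym p) q = ≈ᵢ-sym (++-cong p (≈ᵢ-sym q))
++-cong {β' = β'} (≈ᵢ-trans p p') q = ≈ᵢ-trans (++-cong p q) (++-cong p' (≈ᵢ-refl β'))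

∷-to-front : ∀ α σ β → (α ++ (σ ∷ β)) ≈ᵢ (σ ∷ (α ++ β))
∷-to-front [] σ β = ≈ᵢ-refl (σ ∷ β)
∷-to-front (τ ∷ α) σ β = ≈ᵢ-trans (≈-∷ (≈ˢ-refl τ) (∷-to-front α σ β)) ≈-swap

++-comm-≈ : ∀ α β → (α ++ β) ≈ᵢ (β ++ α)
++-comm-≈ [] β = ≡⇒≈ᵢ (sym (++-identityʳ β))
++-comm-≈ (σ ∷ α) β = ≈ᵢ-trans (≈-∷ (≈ˢ-refl σ) (++-comm-≈ α β)) (≈ᵢ-sym (∷-to-front β σ α))

++-interchange : ∀ α β γ δ → ((α ++ β) ++ (γ ++ δ)) ≈ᵢ ((α ++ γ) ++ (β ++ δ))
++-interchange α β γ δ =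
  ≈ᵢ-trans (≡⇒≈ᵢ (++-assoc α β (γ ++ δ)))
  (≈ᵢ-trans (++-congʳ α (≡⇒≈ᵢ (sym (++-assoc β γ δ))))
  (≈ᵢ-trans (++-congʳ α (++-cong (++-comm-≈ β γ) (≈ᵢ-refl δ)))
  (≈ᵢ-trans (++-congʳ α (≡⇒≈ᵢ (++-assoc γ β δ)))
  (≡⇒≈ᵢ (sym (++-assoc α γ (β ++ δ)))))))

infix 4 _≈ᵐ_
_≈ᵐ_ : Maybe Inter → Maybe Inter → Set
_≈ᵐ_ = Pointwise _≈ᵢ_

≈ᵐ-refl : ∀ {m} → m ≈ᵐ m
≈ᵐ-refl = Pointwise.refl (λ {α} → ≈ᵢ-refl α)

≈ᵐ-sym : ∀ {m n} → m ≈ᵐ n → n ≈ᵐ m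
≈ᵐ-sym = Pointwise.sym ≈ᵢ-sym

≈ᵐ-trans : ∀ {m n k} → m ≈ᵐ n → n ≈ᵐ k → m ≈ᵐ k
≈ᵐ-trans = Pointwise.trans ≈ᵢ-trans

≡⇒≈ᵐ : ∀ {m n} → m ≡ n → m ≈ᵐ n
≡⇒≈ᵐ refl = ≈ᵐ-refl

≈ᵐ-by : ∀ {m n k} → m ≡ k → n ≡ k → m ≈ᵐ n
≈ᵐ-by e₁ e₂ = ≡⇒≈ᵐ (trans e₁ (sym e₂))

≈ᵐ-cast : ∀ {m m' n n'} → m ≡ m' → n ≡ n' → m' ≈ᵐ n' → m ≈ᵐ n
≈ᵐ-cast refl refl p = p

≈ᵐ-nothing→ : ∀ {m n} → m ≈ᵐ n → m ≡ nothing → n ≡ nothing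
≈ᵐ-nothing→ nothing refl = refl

≈ᵐ-nothing← : ∀ {m n} → m ≈ᵐ n → n ≡ nothing → m ≡ nothing
≈ᵐ-nothing← nothing refl = refl

≈ᵐ-just→ : ∀ {m n a} → m ≈ᵐ n → m ≡ just a → ∃ λ b → n ≡ just b
≈ᵐ-just→ (just _) refl = _ , refl

just≢nothing : ∀ {a : Inter} → _≡_ {A = Maybe Inter} (just a) nothing → ⊥
just≢nothing ()

≡just⇒≢nothing : ∀ {m : Maybe Inter} → (∃ λ a → m ≡ just a) → m ≢ nothing
≡just⇒≢nothing (a , e) e' = just≢nothing (trans (sym e) e')

maybe-case : ∀ (m : Maybe Inter) → m ≡ nothing ⊎ ∃ λ a → m ≡ just a
maybe-case nothing = inj₁ refl
maybe-case (just a) = inj₂ (a , refl)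

≈ᶜ-refl : ∀ {Γ} → Γ ≈ᶜ Γ
≈ᶜ-refl x = ≈ᵐ-refl

≈ᶜ-sym : ∀ {Γ Δ} → Γ ≈ᶜ Δ → Δ ≈ᶜ Γ
≈ᶜ-sym p x = ≈ᵐ-sym (p x)

≈ᶜ-trans : ∀ {Γ Δ Θ} → Γ ≈ᶜ Δ → Δ ≈ᶜ Θ → Γ ≈ᶜ Θ
≈ᶜ-trans p q x = ≈ᵐ-trans (p x) (q x)

-- Case split on variable equality.  Unlike 'with a ≟ b' it does not
-- abstract the occurrences of 'a ≟ b' inside basis lookups in the goal.
≡-or-≢ : (a b : Var) → a ≡ b ⊎ a ≢ b
≡-or-≢ a b with a ≟ b
... | yes a≡b = inj₁ a≡b
... | no a≢b = inj₂ a≢b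

ext-here : ∀ Γ x α → (Γ , x ∶ α) x ≡ just α
ext-here Γ x α with x ≟ x
... | yes _ = refl
... | no x≢x = ⊥-elim (x≢x refl)

ext-there : ∀ Γ {x y} α → y ≢ x → (Γ , x ∶ α) y ≡ Γ y
ext-there Γ {x} {y} α y≢x with y ≟ x
... | yes y≡x = ⊥-elim (y≢x y≡x)
... | no _ = refl

ext-nothing⁻ : ∀ Γ {x y α} → (Γ , x ∶ α) y ≡ nothing → y ≢ x × Γ y ≡ nothing
ext-nothing⁻ Γ {x} {y} e with y ≟ x
... | yes _ = ⊥-elim (just≢nothing e)
... | no y≢x = y≢x , e

ext-nothing⁺ : ∀ Γ {x y α} → y ≢ x → Γ y ≡ nothing → (Γ , x ∶ α) y ≡ nothing
ext-nothing⁺ Γ {α = α} y≢x e = trans (ext-there Γ α y≢x) e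

⊎-just : ∀ Γ Δ {y a} → Γ y ≡ just a → (Γ ⊎ᶜ Δ) y ≡ just a
⊎-just Γ Δ {y} e with Γ y
... | just _ = e
... | nothing = ⊥-elim (just≢nothing (sym e))

⊎-nothingˡ : ∀ Γ Δ {y} → Γ y ≡ nothing → (Γ ⊎ᶜ Δ) y ≡ Δ y
⊎-nothingˡ Γ Δ {y} e with Γ y
... | nothing = refl
... | just _ = ⊥-elim (just≢nothing e)

⊎-nothingʳ : ∀ Γ Δ {y} → Δ y ≡ nothing → (Γ ⊎ᶜ Δ) y ≡ Γ y
⊎-nothingʳ Γ Δ {y} e with Γ y
... | just _ = refl
... | nothing = e

⊎-nothing⁻ : ∀ Γ Δ {y} → (Γ ⊎ᶜ Δ) y ≡ nothing → Γ y ≡ nothing × Δ y ≡ nothing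
⊎-nothing⁻ Γ Δ {y} e with Γ y
... | nothing = refl , e
... | just _ = ⊥-elim (just≢nothing e)

⊓-just : ∀ Γ Δ {y a b} → Γ y ≡ just a → Δ y ≡ just b → (Γ ⊓ Δ) y ≡ just (a ++ b)
⊓-just Γ Δ {y} e₁ e₂ with Γ y | Δ y
⊓-just Γ Δ refl refl | just _ | just _ = refl

⊓-nothingˡ : ∀ Γ Δ {y} → Γ y ≡ nothing → (Γ ⊓ Δ) y ≡ nothing
⊓-nothingˡ Γ Δ {y} e with Γ y | Δ y
⊓-nothingˡ Γ Δ refl | nothing | _ = refl

⊓-nothing⁻ : ∀ Γ Δ {y} → (Γ ⊓ Δ) y ≡ nothing → Γ y ≡ nothing ⊎ Δ y ≡ nothing
⊓-nothing⁻ Γ Δ {y} e with Γ y | Δ y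
... | nothing | _ = inj₁ refl
... | just _ | nothing = inj₂ refl
... | just _ | just _ = ⊥-elim (just≢nothing e)

⊓-just⁻ : ∀ Γ Δ {z a} → (Γ ⊓ Δ) z ≡ just a → ∃ λ b → Γ z ≡ just b
⊓-just⁻ Γ Δ {z} e with Γ z | Δ z
... | just b | just _ = b , refl
... | just b | nothing = ⊥-elim (just≢nothing (sym e))
... | nothing | _ = ⊥-elim (just≢nothing (sym e))

ᵀ-just : ∀ Γ {y a} → Γ y ≡ just a → (Γ ᵀ) y ≡ just []
ᵀ-just Γ {y} e with Γ y
ᵀ-just Γ refl | just _ = refl

ᵀ-nothing : ∀ Γ {y} → Γ y ≡ nothing → (Γ ᵀ) y ≡ nothing
ᵀ-nothing Γ {y} e with Γ y
ᵀ-nothing Γ refl | nothing = refl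

ᵀ-nothing⁻ : ∀ Γ {y} → (Γ ᵀ) y ≡ nothing → Γ y ≡ nothing
ᵀ-nothing⁻ Γ {y} e with Γ y
... | nothing = refl
... | just _ = ⊥-elim (just≢nothing e)

ᵀ-just⁻ : ∀ Γ {z a} → (Γ ᵀ) z ≡ just a → ∃ λ b → Γ z ≡ just b
ᵀ-just⁻ Γ {z} e with Γ z
... | just b = b , refl
... | nothing = ⊥-elim (just≢nothing (sym e))

del : Var → Basis → Basis
del x Γ y with y ≟ x
... | yes _ = nothing
... | no _ = Γ y

del-here : ∀ x Γ → del x Γ x ≡ nothing
del-here x Γ with x ≟ x
... | yes _ = refl
... | no x≢x = ⊥-elim (x≢x refl)

del-there : ∀ {x y} Γ → y ≢ x → del x Γ y ≡ Γ y
del-there {x} {y} Γ y≢x with y ≟ x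
... | yes y≡x = ⊥-elim (y≢x y≡x)
... | no _ = refl

del-just⁻ : ∀ {k Γ w a} → del k Γ w ≡ just a → Γ w ≡ just a
del-just⁻ {k} {Γ} {w} e with ≡-or-≢ w k
... | inj₁ refl = ⊥-elim (just≢nothing (trans (sym e) (del-here w Γ)))
... | inj₂ w≢k = trans (sym (del-there Γ w≢k)) e

-- Congruence of the basis operations, stated entrywise at two (possibly
-- different) points so that they also serve for renamed bases.

⊎-cong-at : ∀ {A A' B B' a b} → A' a ≈ᵐ A b → B' a ≈ᵐ B b → (A' ⊎ᶜ B') a ≈ᵐ (A ⊎ᶜ B) b
⊎-cong-at {A} {A'} {a = a} {b} p q with A' a | A b | p
... | just _ | just _ | just r = just r
... | nothing | nothing | nothing = q

⊓-cong-at : ∀ {A A' B B' a b} → A' a ≈ᵐ A b → B' a ≈ᵐ B b → (A' ⊓ B') a ≈ᵐ (A ⊓ B) b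
⊓-cong-at {A} {A'} {B} {B'} {a} {b} p q with A' a | A b | p | B' a | B b | q
... | just _ | just _ | just r | just _ | just _ | just s = just (++-cong r s)
... | just _ | just _ | just r | nothing | nothing | nothing = nothing
... | nothing | nothing | nothing | just _ | just _ | just s = nothing
... | nothing | nothing | nothing | nothing | nothing | nothing = nothing

ᵀ-cong-at : ∀ {A A' a b} → A' a ≈ᵐ A b → (A' ᵀ) a ≈ᵐ (A ᵀ) b
ᵀ-cong-at {A} {A'} {a} {b} p with A' a | A b | p
... | just _ | just _ | just _ = just ≈-[]
... | nothing | nothing | nothing = nothing

ext-cong : ∀ {Γ Γ' x α β} → Γ ≈ᶜ Γ' → α ≈ᵢ β → (Γ , x ∶ α) ≈ᶜ (Γ' , x ∶ β)
ext-cong {Γ} {Γ'} {x} {α} {β} p q y with ≡-or-≢ y x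
... | inj₁ refl = ≈ᵐ-cast (ext-here Γ y α) (ext-here Γ' y β) (just q)
... | inj₂ y≢x = ≈ᵐ-cast (ext-there Γ α y≢x) (ext-there Γ' β y≢x) (p y)

del-cong : ∀ {Γ Γ' y} → Γ ≈ᶜ Γ' → del y Γ ≈ᶜ del y Γ'
del-cong {Γ} {Γ'} {y} p z with ≡-or-≢ z y
... | inj₁ refl = ≈ᵐ-by (del-here z Γ) (del-here z Γ')
... | inj₂ z≢y = ≈ᵐ-cast (del-there Γ z≢y) (del-there Γ' z≢y) (p z)

⊎-congˡ : ∀ {Γ Γ' Δ} → Γ ≈ᶜ Γ' → (Γ ⊎ᶜ Δ) ≈ᶜ (Γ' ⊎ᶜ Δ)
⊎-congˡ {Γ} {Γ'} p z = ⊎-cong-at {Γ'} {Γ} {a = z} {b = z} (p z) ≈ᵐ-refl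

⊎-congʳ : ∀ {Γ Δ Δ'} → Δ ≈ᶜ Δ' → (Γ ⊎ᶜ Δ) ≈ᶜ (Γ ⊎ᶜ Δ')
⊎-congʳ {Γ} p z = ⊎-cong-at {Γ} {Γ} {a = z} {b = z} ≈ᵐ-refl (p z)

⊓-cong : ∀ {Γ Γ' Δ Δ'} → Γ ≈ᶜ Γ' → Δ ≈ᶜ Δ' → (Γ ⊓ Δ) ≈ᶜ (Γ' ⊓ Δ')
⊓-cong {Γ} {Γ'} {Δ} {Δ'} p q z = ⊓-cong-at {Γ'} {Γ} {Δ'} {Δ} {a = z} {b = z} (p z) (q z)

ᵀ-cong : ∀ {Γ Γ'} → Γ ≈ᶜ Γ' → (Γ ᵀ) ≈ᶜ (Γ' ᵀ)
ᵀ-cong {Γ} {Γ'} p z = ᵀ-cong-at {Γ'} {Γ} {a = z} {b = z} (p z)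

ext-swap : ∀ {Γ x y α β} → x ≢ y → ((Γ , x ∶ α) , y ∶ β) ≈ᶜ ((Γ , y ∶ β) , x ∶ α)
ext-swap {Γ} {x} {y} {α} {β} x≢y z with ≡-or-≢ z y | ≡-or-≢ z x
... | inj₁ refl | inj₁ refl = ⊥-elim (x≢y refl)
... | inj₁ refl | inj₂ z≢x = ≈ᵐ-by (ext-here _ z β) (trans (ext-there _ α z≢x) (ext-here Γ z β))
... | inj₂ z≢y | inj₁ refl = ≈ᵐ-by (trans (ext-there _ β z≢y) (ext-here Γ z α)) (ext-here _ z α)
... | inj₂ z≢y | inj₂ z≢x =
  ≈ᵐ-by (trans (ext-there _ β z≢y) (ext-there Γ α z≢x)) (trans (ext-there _ α z≢x) (ext-there Γ β z≢y))

del-ext : ∀ {Γ x y α} → y ≢ x → del y (Γ , x ∶ α) ≈ᶜ (del y Γ , x ∶ α)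
del-ext {Γ} {x} {y} {α} y≢x z with ≡-or-≢ z y | ≡-or-≢ z x
... | inj₁ refl | inj₁ refl = ⊥-elim (y≢x refl)
... | inj₁ refl | inj₂ z≢x = ≈ᵐ-by (del-here z _) (trans (ext-there _ α z≢x) (del-here z Γ))
... | inj₂ z≢y | inj₁ refl = ≈ᵐ-by (trans (del-there _ z≢y) (ext-here Γ z α)) (ext-here _ z α)
... | inj₂ z≢y | inj₂ z≢x =
  ≈ᵐ-by (trans (del-there _ z≢y) (ext-there Γ α z≢x)) (trans (ext-there _ α z≢x) (del-there Γ z≢y))

del-ext-same : ∀ {Γ y α} → del y (Γ , y ∶ α) ≈ᶜ del y Γ
del-ext-same {Γ} {y} {α} z with ≡-or-≢ z y
... | inj₁ refl = ≈ᵐ-by (del-here z _) (del-here z Γ)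
... | inj₂ z≢y = ≈ᵐ-by (trans (del-there _ z≢y) (ext-there Γ α z≢y)) (del-there Γ z≢y)

del-fresh : ∀ {Γ y} → Γ y ≡ nothing → Γ ≈ᶜ del y Γ
del-fresh {Γ} {y} e z with ≡-or-≢ z y
... | inj₁ refl = ≈ᵐ-by e (del-here z Γ)
... | inj₂ z≢y = ≡⇒≈ᵐ (sym (del-there Γ z≢y))

split-at : ∀ {Γ y α} → Γ y ≈ᵐ just α → Γ ≈ᶜ (del y Γ , y ∶ α)
split-at {Γ} {y} {α} p z with ≡-or-≢ z y
... | inj₁ refl = ≈ᵐ-cast refl (ext-here _ z α) p
... | inj₂ z≢y = ≡⇒≈ᵐ (sym (trans (ext-there _ α z≢y) (del-there Γ z≢y)))

del-⊎ : ∀ {A B y} → B y ≡ nothing → del y (A ⊎ᶜ B) ≈ᶜ (del y A ⊎ᶜ B)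
del-⊎ {A} {B} {y} e z with ≡-or-≢ z y
... | inj₁ refl = ≈ᵐ-by (del-here z _) (trans (⊎-nothingˡ (del y A) B (del-here z A)) e)
... | inj₂ z≢y = ≈ᵐ-cast (del-there _ z≢y) refl
                   (⊎-cong-at {del y A} {A} {B} {B} {a = z} {b = z} (≡⇒≈ᵐ (sym (del-there A z≢y))) ≈ᵐ-refl)

ext-⊎ˡ : ∀ {Γ₁ Γ₂ x α} → ((Γ₁ , x ∶ α) ⊎ᶜ Γ₂) ≈ᶜ ((Γ₁ ⊎ᶜ Γ₂) , x ∶ α)
ext-⊎ˡ {Γ₁} {Γ₂} {x} {α} z with ≡-or-≢ z x
... | inj₁ refl = ≈ᵐ-by (⊎-just (Γ₁ , z ∶ α) Γ₂ {z} (ext-here Γ₁ z α)) (ext-here _ z α)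
... | inj₂ z≢x = ≈ᵐ-cast refl (ext-there _ α z≢x)
                   (⊎-cong-at {Γ₁} {Γ₁ , x ∶ α} {Γ₂} {Γ₂} {a = z} {b = z} (≡⇒≈ᵐ (ext-there Γ₁ α z≢x)) ≈ᵐ-refl)

ext-⊎ʳ : ∀ {Γ₁ Γ₂ x α} → Γ₁ x ≡ nothing → (Γ₁ ⊎ᶜ (Γ₂ , x ∶ α)) ≈ᶜ ((Γ₁ ⊎ᶜ Γ₂) , x ∶ α)
ext-⊎ʳ {Γ₁} {Γ₂} {x} {α} e z with ≡-or-≢ z x
... | inj₁ refl = ≈ᵐ-by (trans (⊎-nothingˡ Γ₁ (Γ₂ , z ∶ α) e) (ext-here Γ₂ z α)) (ext-here _ z α)
... | inj₂ z≢x = ≈ᵐ-cast refl (ext-there _ α z≢x)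
                   (⊎-cong-at {Γ₁} {Γ₁} {a = z} {b = z} ≈ᵐ-refl (≡⇒≈ᵐ (ext-there Γ₂ α z≢x)))

⊓-ext : ∀ {Γ Δ x α β} → ((Γ , x ∶ α) ⊓ (Δ , x ∶ β)) ≈ᶜ ((Γ ⊓ Δ) , x ∶ (α ++ β))
⊓-ext {Γ} {Δ} {x} {α} {β} z with ≡-or-≢ z x
... | inj₁ refl = ≈ᵐ-by (⊓-just (Γ , z ∶ α) (Δ , z ∶ β) {z} (ext-here Γ z α) (ext-here Δ z β))
                        (ext-here _ z (α ++ β))
... | inj₂ z≢x = ≈ᵐ-cast refl (ext-there _ (α ++ β) z≢x)
                   (⊓-cong-at {Γ} {Γ , x ∶ α} {Δ} {Δ , x ∶ β} {a = z} {b = z}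
                     (≡⇒≈ᵐ (ext-there Γ α z≢x)) (≡⇒≈ᵐ (ext-there Δ β z≢x)))

ᵀ-ext : ∀ {Γ x α} → ((Γ , x ∶ α) ᵀ) ≈ᶜ ((Γ ᵀ) , x ∶ [])
ᵀ-ext {Γ} {x} {α} z with ≡-or-≢ z x
... | inj₁ refl = ≈ᵐ-by (ᵀ-just (Γ , z ∶ α) {z} (ext-here Γ z α)) (ext-here _ z [])
... | inj₂ z≢x = ≈ᵐ-cast refl (ext-there _ [] z≢x)
                   (ᵀ-cong-at {Γ} {Γ , x ∶ α} {a = z} {b = z} (≡⇒≈ᵐ (ext-there Γ α z≢x)))

⊎-assoc : ∀ {Γ Δ Θ} → ((Γ ⊎ᶜ Δ) ⊎ᶜ Θ) ≈ᶜ (Γ ⊎ᶜ (Δ ⊎ᶜ Θ))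
⊎-assoc {Γ} {Δ} z with Γ z | Δ z
... | just _ | _ = ≈ᵐ-refl
... | nothing | just _ = ≈ᵐ-refl
... | nothing | nothing = ≈ᵐ-refl

⊎-∅ : ∀ {Γ} → (Γ ⊎ᶜ ∅) ≈ᶜ Γ
⊎-∅ {Γ} z with Γ z
... | just _ = ≈ᵐ-refl
... | nothing = nothing

⊓-assoc : ∀ {A B C} → (A ⊓ (B ⊓ C)) ≈ᶜ ((A ⊓ B) ⊓ C)
⊓-assoc {A} {B} {C} z with A z | B z | C z
... | just a | just b | just c = just (≡⇒≈ᵢ (sym (++-assoc a b c)))
... | just _ | just _ | nothing = nothing
... | just _ | nothing | just _ = nothing
... | just _ | nothing | nothing = nothing
... | nothing | just _ | just _ = nothing
... | nothing | just _ | nothing = nothing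
... | nothing | nothing | just _ = nothing
... | nothing | nothing | nothing = nothing

ᵀ-⊎ : ∀ {A B} → ((A ⊎ᶜ B) ᵀ) ≈ᶜ ((A ᵀ) ⊎ᶜ (B ᵀ))
ᵀ-⊎ {A} {B} z with A z | B z
... | just _ | _ = ≈ᵐ-refl
... | nothing | just _ = ≈ᵐ-refl
... | nothing | nothing = ≈ᵐ-refl

-- Γ ≈ Γ ⊓ Γ^⊤ : the argument basis of a variable used exactly once
⊓-ᵀ-self : ∀ Γ → Γ ≈ᶜ (Γ ⊓ (Γ ᵀ))
⊓-ᵀ-self Γ z with maybe-case (Γ z)
... | inj₁ e = ≈ᵐ-cast e (⊓-nothingˡ Γ (Γ ᵀ) e) nothing
... | inj₂ (a , e) = ≈ᵐ-cast e (⊓-just Γ (Γ ᵀ) e (ᵀ-just Γ e)) (just (≡⇒≈ᵢ (sym (++-identityʳ a))))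

dis-sym : ∀ {Γ Δ} → DisjointDom Γ Δ → DisjointDom Δ Γ
dis-sym d z with d z
... | inj₁ e = inj₂ e
... | inj₂ e = inj₁ e

dis-≈ˡ : ∀ {Γ Γ' Δ} → Γ ≈ᶜ Γ' → DisjointDom Γ Δ → DisjointDom Γ' Δ
dis-≈ˡ p d z with d z
... | inj₁ e = inj₁ (≈ᵐ-nothing→ (p z) e)
... | inj₂ e = inj₂ e

dis-≈ʳ : ∀ {Γ Δ Δ'} → Δ ≈ᶜ Δ' → DisjointDom Γ Δ → DisjointDom Γ Δ'
dis-≈ʳ p d = dis-sym (dis-≈ˡ p (dis-sym d))

dis-extˡ⁺ : ∀ {Γ Δ x α} → DisjointDom Γ Δ → Δ x ≡ nothing → DisjointDom (Γ , x ∶ α) Δ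
dis-extˡ⁺ {Γ} {Δ} {x} {α} d e z with ≡-or-≢ z x
... | inj₁ refl = inj₂ e
... | inj₂ z≢x with d z
...   | inj₁ e' = inj₁ (trans (ext-there Γ α z≢x) e')
...   | inj₂ e' = inj₂ e'

dis-extˡ⁻ : ∀ {Γ Δ x α} → DisjointDom (Γ , x ∶ α) Δ → Γ x ≡ nothing → DisjointDom Γ Δ
dis-extˡ⁻ {Γ} {Δ} {x} {α} d e z with ≡-or-≢ z x | d z
... | inj₁ refl | _ = inj₁ e
... | inj₂ z≢x | inj₁ e' = inj₁ (trans (sym (ext-there Γ α z≢x)) e')
... | inj₂ z≢x | inj₂ e' = inj₂ e'

dis-extʳ⁺ : ∀ {Γ Δ x α} → DisjointDom Γ Δ → Γ x ≡ nothing → DisjointDom Γ (Δ , x ∶ α)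
dis-extʳ⁺ d e = dis-sym (dis-extˡ⁺ (dis-sym d) e)

dis-extʳ⁻ : ∀ {Γ Δ x α} → DisjointDom Γ (Δ , x ∶ α) → Δ x ≡ nothing → DisjointDom Γ Δ
dis-extʳ⁻ d e = dis-sym (dis-extˡ⁻ (dis-sym d) e)

dis-del : ∀ {Γ Δ y} → DisjointDom Γ Δ → DisjointDom (del y Γ) Δ
dis-del {Γ} {Δ} {y} d z with ≡-or-≢ z y
... | inj₁ refl = inj₁ (del-here z Γ)
... | inj₂ z≢y with d z
...   | inj₁ e = inj₁ (trans (del-there Γ z≢y) e)
...   | inj₂ e = inj₂ e

dis-⊎ˡ : ∀ {A B C} → DisjointDom A C → DisjointDom B C → DisjointDom (A ⊎ᶜ B) C
dis-⊎ˡ {A} {B} d₁ d₂ z with d₁ z | d₂ z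
... | inj₂ e | _ = inj₂ e
... | inj₁ _ | inj₂ e = inj₂ e
... | inj₁ e₁ | inj₁ e₂ = inj₁ (trans (⊎-nothingˡ A B e₁) e₂)

dis-⊎ʳ⁻ : ∀ {A B C D} → DisjointDom A B → B ≈ᶜ (C ⊎ᶜ D) → DisjointDom A C × DisjointDom A D
dis-⊎ʳ⁻ {A} {B} {C} {D} d c = (λ z → proj₁ (parts z)) , (λ z → proj₂ (parts z))
  where
  parts : ∀ z → (A z ≡ nothing ⊎ C z ≡ nothing) × (A z ≡ nothing ⊎ D z ≡ nothing)
  parts z with d z
  ... | inj₁ e = inj₁ e , inj₁ e
  ... | inj₂ e = let (eC , eD) = ⊎-nothing⁻ C D (≈ᵐ-nothing→ (c z) e) in inj₂ eC , inj₂ eD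

⊎-swap₂₃ : ∀ {Γ Δ Θ} → DisjointDom Δ Θ → ((Γ ⊎ᶜ Δ) ⊎ᶜ Θ) ≈ᶜ ((Γ ⊎ᶜ Θ) ⊎ᶜ Δ)
⊎-swap₂₃ {Γ} {Δ} {Θ} d z with maybe-case (Γ z)
... | inj₂ (a , e) = ≈ᵐ-by (⊎-just (Γ ⊎ᶜ Δ) Θ (⊎-just Γ Δ e)) (⊎-just (Γ ⊎ᶜ Θ) Δ (⊎-just Γ Θ e))
... | inj₁ e with d z
...   | inj₁ eΔ = ≈ᵐ-cast (trans (⊎-nothingˡ (Γ ⊎ᶜ Δ) Θ (trans (⊎-nothingˡ Γ Δ e) eΔ)) (sym (⊎-nothingˡ Γ Θ e)))
                        (⊎-nothingʳ (Γ ⊎ᶜ Θ) Δ eΔ) ≈ᵐ-refl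
...   | inj₂ eΘ = ≈ᵐ-cast (⊎-nothingʳ (Γ ⊎ᶜ Δ) Θ eΘ)
                        (trans (⊎-nothingˡ (Γ ⊎ᶜ Θ) Δ (trans (⊎-nothingˡ Γ Θ e) eΘ)) (sym (⊎-nothingˡ Γ Δ e)))
                        ≈ᵐ-refl

sd-sym : ∀ {Γ Δ} → SameDom Γ Δ → SameDom Δ Γ
sd-sym s z = proj₂ (s z) , proj₁ (s z)

sd-≈ : ∀ {Γ Γ' Δ Δ'} → Γ ≈ᶜ Γ' → Δ ≈ᶜ Δ' → SameDom Γ Δ → SameDom Γ' Δ'
sd-≈ p q s z =
  (λ e → ≈ᵐ-nothing→ (q z) (proj₁ (s z) (≈ᵐ-nothing← (p z) e))) ,
  (λ e → ≈ᵐ-nothing→ (p z) (proj₂ (s z) (≈ᵐ-nothing← (q z) e)))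

sd-ext⁺ : ∀ {Γ Δ x α β} → SameDom Γ Δ → SameDom (Γ , x ∶ α) (Δ , x ∶ β)
sd-ext⁺ {Γ} {Δ} {x} {α} {β} s z with ≡-or-≢ z x
... | inj₁ refl = (λ e → ⊥-elim (just≢nothing (trans (sym (ext-here Γ z α)) e))) ,
                  (λ e → ⊥-elim (just≢nothing (trans (sym (ext-here Δ z β)) e)))
... | inj₂ z≢x = (λ e → trans (ext-there Δ β z≢x) (proj₁ (s z) (trans (sym (ext-there Γ α z≢x)) e))) ,
                 (λ e → trans (ext-there Γ α z≢x) (proj₂ (s z) (trans (sym (ext-there Δ β z≢x)) e)))

sd-ext⁻ : ∀ {Γ Δ x α β} → SameDom (Γ , x ∶ α) (Δ , x ∶ β) → Γ x ≡ nothing → Δ x ≡ nothing → SameDom Γ Δ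
sd-ext⁻ {Γ} {Δ} {x} {α} {β} s eΓ eΔ z with ≡-or-≢ z x
... | inj₁ refl = (λ _ → eΔ) , (λ _ → eΓ)
... | inj₂ z≢x = (λ e → trans (sym (ext-there Δ β z≢x)) (proj₁ (s z) (trans (ext-there Γ α z≢x) e))) ,
                 (λ e → trans (sym (ext-there Γ α z≢x)) (proj₂ (s z) (trans (ext-there Δ β z≢x) e)))

sd-ᵀ : ∀ Γ → SameDom Γ (Γ ᵀ)
sd-ᵀ Γ z with Γ z
... | just _ = (λ ()) , (λ ())
... | nothing = (λ _ → refl) , (λ _ → refl)

ᵀ-sd : ∀ {A B} → SameDom A B → (A ᵀ) ≈ᶜ (B ᵀ)
ᵀ-sd {A} {B} sd z with A z | B z | sd z
... | just _ | just _ | _ = ≈ᵐ-refl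
... | nothing | nothing | _ = ≈ᵐ-refl
... | just _ | nothing | (_ , h) = ⊥-elim (just≢nothing (h refl))
... | nothing | just _ | (h , _) = ⊥-elim (just≢nothing (h refl))

⊓-ᵀˡ : ∀ {A D} → SameDom A D → ((A ᵀ) ⊓ D) ≈ᶜ D
⊓-ᵀˡ {A} {D} sd z with A z | D z | sd z
... | just _ | just _ | _ = ≈ᵐ-refl
... | nothing | nothing | _ = ≈ᵐ-refl
... | just _ | nothing | (_ , h) = ⊥-elim (just≢nothing (h refl))
... | nothing | just _ | (h , _) = ⊥-elim (just≢nothing (h refl))

⊓-⊎-distrib : ∀ {A₁ A₂ B₁ B₂} → SameDom A₁ A₂ →
              ((A₁ ⊎ᶜ B₁) ⊓ (A₂ ⊎ᶜ B₂)) ≈ᶜ ((A₁ ⊓ A₂) ⊎ᶜ (B₁ ⊓ B₂))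
⊓-⊎-distrib {A₁} {A₂} {B₁} {B₂} sd z with A₁ z | A₂ z | sd z
... | just _ | just _ | _ = ≈ᵐ-refl
... | just _ | nothing | (_ , h) = ⊥-elim (just≢nothing (h refl))
... | nothing | just _ | (h , _) = ⊥-elim (just≢nothing (h refl))
... | nothing | nothing | _ with B₁ z | B₂ z
...   | just _ | just _ = ≈ᵐ-refl
...   | just _ | nothing = ≈ᵐ-refl
...   | nothing | just _ = ≈ᵐ-refl
...   | nothing | nothing = ≈ᵐ-refl

∈-remove⁻ : ∀ {z x} l → z ∈ remove x l → z ∈ l × z ≢ x
∈-remove⁻ {z} {x} (y ∷ l) p with y ≟ x
... | yes _ = let (z∈l , z≢x) = ∈-remove⁻ l p in there z∈l , z≢x
∈-remove⁻ (y ∷ l) (here refl) | no y≢x = here refl , y≢x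
∈-remove⁻ (y ∷ l) (there p) | no _ = let (z∈l , z≢x) = ∈-remove⁻ l p in there z∈l , z≢x

∈-remove⁺ : ∀ {z x} l → z ∈ l → z ≢ x → z ∈ remove x l
∈-remove⁺ {z} {x} (y ∷ l) p z≢x with y ≟ x
∈-remove⁺ (y ∷ l) (here refl) z≢x | yes y≡x = ⊥-elim (z≢x y≡x)
∈-remove⁺ (y ∷ l) (there p) z≢x | yes _ = ∈-remove⁺ l p z≢x
∈-remove⁺ (y ∷ l) (here refl) z≢x | no _ = here refl
∈-remove⁺ (y ∷ l) (there p) z≢x | no _ = there (∈-remove⁺ l p z≢x)

∈-remove₂⁺ : ∀ {z x₁ x₂} l → z ∈ l → z ≢ x₂ → z ≢ x₁ → z ∈ remove x₁ (remove x₂ l)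
∈-remove₂⁺ l z∈l z≢x₂ z≢x₁ = ∈-remove⁺ _ (∈-remove⁺ l z∈l z≢x₂) z≢x₁

∈-remove₂⁻ : ∀ {z x₁ x₂} l → z ∈ remove x₁ (remove x₂ l) → z ∈ l × z ≢ x₂ × z ≢ x₁
∈-remove₂⁻ l m =
  let (m₁ , z≢x₁) = ∈-remove⁻ _ m
      (m₂ , z≢x₂) = ∈-remove⁻ l m₁
  in m₂ , z≢x₂ , z≢x₁

fv⊆vars : ∀ {v} T → v ∈ fv T → v ∈ vars T
fv⊆vars (` x) m = m
fv⊆vars (ƛ x ⇒ M) m = there (fv⊆vars M (proj₁ (∈-remove⁻ (fv M) m)))
fv⊆vars (M · N) m with ∈-++⁻ (fv M) m
... | inj₁ m' = ∈-++⁺ˡ (fv⊆vars M m')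
... | inj₂ m' = ∈-++⁺ʳ (vars M) (fv⊆vars N m')
fv⊆vars (x ⊙ M) (here e) = here e
fv⊆vars (x ⊙ M) (there m) = there (fv⊆vars M m)
fv⊆vars (dup x x₁ x₂ M) (here e) = here e
fv⊆vars (dup x x₁ x₂ M) (there m) = there (there (there (fv⊆vars M (proj₁ (∈-remove₂⁻ (fv M) m)))))

fv-erasures : ∀ xs M → fv (erasures xs M) ≡ xs ++ fv M
fv-erasures [] M = refl
fv-erasures (x ∷ xs) M = cong (x ∷_) (fv-erasures xs M)

Inj : (Var → Var) → Set
Inj f = Injective _≡_ _≡_ f

∈-map-inj : ∀ {f} → Inj f → ∀ {v} l → f v ∈ map f l → v ∈ l
∈-map-inj {f} inj l m with ∈-map⁻ f m
... | w , w∈l , e = subst (_∈ l) (sym (inj e)) w∈l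

remove-map : ∀ {f} → Inj f → ∀ x l → remove (f x) (map f l) ≡ map f (remove x l)
remove-map {f} inj x [] = refl
remove-map {f} inj x (y ∷ l) with f y ≟ f x | y ≟ x
... | yes _ | yes _ = remove-map inj x l
... | no _ | no _ = cong (f y ∷_) (remove-map inj x l)
... | yes e | no y≢x = ⊥-elim (y≢x (inj e))
... | no fy≢fx | yes e = ⊥-elim (fy≢fx (cong f e))

mutual
  fv-ren : ∀ {f} → Inj f → ∀ T → fv (ren f T) ≡ map f (fv T)
  fv-ren inj (` x) = refl
  fv-ren {f} inj (ƛ x ⇒ M) = trans (cong (remove (f x)) (fv-ren inj M)) (remove-map inj x (fv M))
  fv-ren {f} inj (M · N) = trans (cong₂ _++_ (fv-ren inj M) (fv-ren inj N)) (sym (map-++ f (fv M) (fv N)))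
  fv-ren {f} inj (x ⊙ M) = cong (f x ∷_) (fv-ren inj M)
  fv-ren {f} inj (dup x x₁ x₂ M) = cong (f x ∷_) (fv-ren-dup inj x₁ x₂ M)

  fv-ren-dup : ∀ {f} → Inj f → ∀ x₁ x₂ M →
               remove (f x₁) (remove (f x₂) (fv (ren f M))) ≡ map f (remove x₁ (remove x₂ (fv M)))
  fv-ren-dup {f} inj x₁ x₂ M =
    trans (cong (λ l → remove (f x₁) (remove (f x₂) l)) (fv-ren inj M))
      (trans (cong (remove (f x₁)) (remove-map inj x₂ (fv M))) (remove-map inj x₁ (remove x₂ (fv M))))

∈-fv-ren⁻ : ∀ {f} → Inj f → ∀ T {w} → w ∈ fv (ren f T) → ∃ λ v → v ∈ fv T × w ≡ f v
∈-fv-ren⁻ {f} inj T m = ∈-map⁻ f (subst (_ ∈_) (fv-ren inj T) m)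

∈-fv-ren⁺ : ∀ {f} → Inj f → ∀ T {v} → v ∈ fv T → f v ∈ fv (ren f T)
∈-fv-ren⁺ {f} inj T m = subst (_ ∈_) (sym (fv-ren inj T)) (∈-map⁺ f m)

∉-fv-ren : ∀ {f} → Inj f → ∀ T {w} → w ∉ map f (fv T) → w ∉ fv (ren f T)
∉-fv-ren inj T w∉ m = w∉ (subst (_ ∈_) (fv-ren inj T) m)

mutual
  dom-∉ : ∀ {Γ M σ z} → Γ ⊢ M ∶ σ → z ∉ fv M → Γ z ≡ nothing
  dom-∉ {z = z} (Ax {x}) z∉ with ≡-or-≢ z x
  ... | inj₁ z≡x = ⊥-elim (z∉ (here z≡x))
  ... | inj₂ z≢x = ext-there ∅ _ z≢x
  dom-∉ {z = z} (→I {Γ} {x} {α} {M} Γx d) z∉ with ≡-or-≢ z x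
  ... | inj₁ refl = Γx
  ... | inj₂ z≢x = trans (sym (ext-there Γ α z≢x)) (dom-∉ d (λ m → z∉ (∈-remove⁺ (fv M) m z≢x)))
  dom-∉ (→E {Γ} {Δ} {M} d ds _) z∉ =
    trans (⊎-nothingˡ Γ Δ (dom-∉ d (λ m → z∉ (∈-++⁺ˡ m)))) (dom*-∉ ds (λ m → z∉ (∈-++⁺ʳ (fv M) m)))
  dom-∉ {z = z} (Cont {Γ} {x} {y} {z'} {α} {β} {M} Γx Γy _ d) z∉ with ≡-or-≢ z z' | ≡-or-≢ z x | ≡-or-≢ z y
  ... | inj₁ z≡z' | _ | _ = ⊥-elim (z∉ (here z≡z'))
  ... | inj₂ z≢z' | inj₁ refl | _ = trans (ext-there Γ (α ++ β) z≢z') Γx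
  ... | inj₂ z≢z' | inj₂ z≢x | inj₁ refl = trans (ext-there Γ (α ++ β) z≢z') (trans (sym (ext-there Γ α z≢x)) Γy)
  ... | inj₂ z≢z' | inj₂ z≢x | inj₂ z≢y =
    trans (ext-there Γ (α ++ β) z≢z') (trans (sym (ext-there Γ α z≢x)) (trans (sym (ext-there (Γ , x ∶ α) β z≢y))
      (dom-∉ d (λ m → z∉ (there (∈-remove₂⁺ (fv M) m z≢y z≢x))))))
  dom-∉ {z = z} (Thin {Γ} {x} _ d) z∉ with ≡-or-≢ z x
  ... | inj₁ z≡x = ⊥-elim (z∉ (here z≡x))
  ... | inj₂ z≢x = trans (ext-there Γ [] z≢x) (dom-∉ d (λ m → z∉ (there m)))
  dom-∉ {z = z} (Conv d p _) z∉ = ≈ᵐ-nothing→ (p z) (dom-∉ d z∉)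

  dom*-∉ : ∀ {Δ N τs z} → Δ ⊢* N ∶ τs → z ∉ fv N → Δ z ≡ nothing
  dom*-∉ (arg₀ {Δ₀} d) z∉ = ᵀ-nothing Δ₀ (dom-∉ d z∉)
  dom*-∉ (arg+ {Δᵢ} {Δ} d _ _) z∉ = ⊓-nothingˡ Δᵢ Δ (dom-∉ d z∉)

mutual
  dom-∈ : ∀ {Γ M σ z} → Γ ⊢ M ∶ σ → z ∈ fv M → ∃ λ a → Γ z ≡ just a
  dom-∈ (Ax {x} {σ}) (here refl) = _ , ext-here ∅ x (σ ∷ [])
  dom-∈ (→I {Γ} {x} {α} {M} _ d) m =
    let (m' , z≢x) = ∈-remove⁻ (fv M) m
        (a , e) = dom-∈ d m'
    in a , trans (sym (ext-there Γ α z≢x)) e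
  dom-∈ {z = z} (→E {Γ} {Δ} {M} d ds dis) m with ∈-++⁻ (fv M) m
  ... | inj₁ m' = let (a , e) = dom-∈ d m' in a , ⊎-just Γ Δ e
  ... | inj₂ m' = let (a , e) = dom*-∈ ds m' in a , trans (⊎-nothingˡ Γ Δ (Γz e)) e
    where
    Γz : ∀ {a} → Δ z ≡ just a → Γ z ≡ nothing
    Γz e with dis z
    ... | inj₁ e' = e'
    ... | inj₂ e' = ⊥-elim (just≢nothing (trans (sym e) e'))
  dom-∈ (Cont {Γ} {z = z} {α} {β} _ _ _ _) (here refl) = _ , ext-here Γ z (α ++ β)
  dom-∈ {z = z} (Cont {Γ} {x} {y} {z'} {α} {β} {M} _ _ _ d) (there m) with ≡-or-≢ z z'
  ... | inj₁ refl = _ , ext-here Γ z (α ++ β)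
  ... | inj₂ z≢z' =
    let (m₁ , z≢x) = ∈-remove⁻ _ m
        (m₂ , z≢y) = ∈-remove⁻ (fv M) m₁
        (a , e) = dom-∈ d m₂
    in a , trans (ext-there Γ (α ++ β) z≢z')
             (trans (sym (ext-there Γ α z≢x)) (trans (sym (ext-there (Γ , x ∶ α) β z≢y)) e))
  dom-∈ (Thin {Γ} {x} _ d) (here refl) = _ , ext-here Γ x []
  dom-∈ {z = z} (Thin {Γ} {x} _ d) (there m) with ≡-or-≢ z x
  ... | inj₁ refl = _ , ext-here Γ x []
  ... | inj₂ z≢x = let (a , e) = dom-∈ d m in a , trans (ext-there Γ [] z≢x) e
  dom-∈ {z = z} (Conv d p _) m = ≈ᵐ-just→ (p z) (proj₂ (dom-∈ d m))

  dom*-∈ : ∀ {Δ N τs z} → Δ ⊢* N ∶ τs → z ∈ fv N → ∃ λ a → Δ z ≡ just a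
  dom*-∈ (arg₀ {Δ₀} d) m = _ , ᵀ-just Δ₀ (proj₂ (dom-∈ d m))
  dom*-∈ (arg+ {Δᵢ} {Δ} d ds _) m = _ , ⊓-just Δᵢ Δ (proj₂ (dom-∈ d m)) (proj₂ (dom*-∈ ds m))

dom*-nothing⇒∉ : ∀ {Δ N τs z} → Δ ⊢* N ∶ τs → Δ z ≡ nothing → z ∉ fv N
dom*-nothing⇒∉ ds e m = ≡just⇒≢nothing (dom*-∈ ds m) e

sd-⊢ : ∀ {Γ Δ N σ τs} → Γ ⊢ N ∶ σ → Δ ⊢* N ∶ τs → SameDom Γ Δ
sd-⊢ {N = N} d ds z with z ∈? fv N
... | yes m = (λ e → ⊥-elim (≡just⇒≢nothing (dom-∈ d m) e)) , (λ e → ⊥-elim (≡just⇒≢nothing (dom*-∈ ds m) e))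
... | no z∉ = (λ _ → dom*-∉ ds z∉) , (λ _ → dom-∉ d z∉)

-- Generation lemmas: inverting the last rule of a derivation, up to the
-- conversion rule (which is pushed to the bases and the result type).

record AbsInv (Γ : Basis) (x : Var) (M : Term) (σ : Strict) : Set where
  constructor absInv
  field
    {Γ'} : Basis
    {α} : Inter
    {σ'} : Strict
    fresh : Γ' x ≡ nothing
    body : (Γ' , x ∶ α) ⊢ M ∶ σ'
    type≈ : (α ⇒ σ') ≈ˢ σ
    basis≈ : Γ ≈ᶜ Γ'

invAbs : ∀ {Γ x M σ} → Γ ⊢ ƛ x ⇒ M ∶ σ → AbsInv Γ x M σ
invAbs (→I Γx d) = absInv Γx d (≈ˢ-refl _) ≈ᶜ-refl
invAbs (Conv d p q) with invAbs d
... | absInv fr d' t c = absInv fr d' (≈ˢ-trans t q) (≈ᶜ-trans (≈ᶜ-sym p) c)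

record AppInv (Γ : Basis) (M N : Term) (σ : Strict) : Set where
  constructor appInv
  field
    {Γ₁ Γ₂} : Basis
    {τs} : Inter
    fun : Γ₁ ⊢ M ∶ (τs ⇒ σ)
    arg : Γ₂ ⊢* N ∶ τs
    disjoint : DisjointDom Γ₁ Γ₂
    basis≈ : Γ ≈ᶜ (Γ₁ ⊎ᶜ Γ₂)

invApp : ∀ {Γ M N σ} → Γ ⊢ M · N ∶ σ → AppInv Γ M N σ
invApp (→E d ds dis) = appInv d ds dis ≈ᶜ-refl
invApp (Conv d p q) with invApp d
... | appInv {τs = τs} d₁ d₂ dis c =
  appInv (Conv d₁ ≈ᶜ-refl (≈-arr (≈ᵢ-refl τs) q)) d₂ dis (≈ᶜ-trans (≈ᶜ-sym p) c)

record EraInv (Γ : Basis) (x : Var) (M : Term) (σ : Strict) : Set where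
  constructor eraInv
  field
    {Γ'} : Basis
    fresh : Γ' x ≡ nothing
    body : Γ' ⊢ M ∶ σ
    basis≈ : Γ ≈ᶜ (Γ' , x ∶ [])

invEra : ∀ {Γ x M σ} → Γ ⊢ x ⊙ M ∶ σ → EraInv Γ x M σ
invEra (Thin Γx d) = eraInv Γx d ≈ᶜ-refl
invEra (Conv d p q) with invEra d
... | eraInv fr d' c = eraInv fr (Conv d' ≈ᶜ-refl q) (≈ᶜ-trans (≈ᶜ-sym p) c)

record DupInv (Γ : Basis) (z x y : Var) (M : Term) (σ : Strict) : Set where
  constructor dupInv
  field
    {Γ'} : Basis
    {α β} : Inter
    fresh₁ : Γ' x ≡ nothing
    fresh₂ : (Γ' , x ∶ α) y ≡ nothing
    fresh : Γ' z ≡ nothing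
    body : ((Γ' , x ∶ α) , y ∶ β) ⊢ M ∶ σ
    basis≈ : Γ ≈ᶜ (Γ' , z ∶ (α ++ β))

invDup : ∀ {Γ z x y M σ} → Γ ⊢ dup z x y M ∶ σ → DupInv Γ z x y M σ
invDup (Cont a b c d) = dupInv a b c d ≈ᶜ-refl
invDup (Conv d p q) with invDup d
... | dupInv a b c d' ctx = dupInv a b c (Conv d' ≈ᶜ-refl q) (≈ᶜ-trans (≈ᶜ-sym p) ctx)

invVar : ∀ {Γ x σ} → Γ ⊢ ` x ∶ σ → Γ ≈ᶜ (∅ , x ∶ (σ ∷ []))
invVar Ax = ≈ᶜ-refl
invVar (Conv d p q) = ≈ᶜ-trans (≈ᶜ-sym p) (≈ᶜ-trans (invVar d) (ext-cong ≈ᶜ-refl (≈-∷ q ≈-[])))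

thin* : ∀ {Δ N τs x} → Δ ⊢* N ∶ τs → Δ x ≡ nothing →
        Σ Basis λ D → D ⊢* x ⊙ N ∶ τs × D ≈ᶜ (Δ , x ∶ [])
thin* {x = x} (arg₀ {Δ₀} d) e = _ , arg₀ (Thin (ᵀ-nothing⁻ Δ₀ e) d) , ᵀ-ext {Δ₀} {x} {[]}
thin* {x = x} (arg+ {Δᵢ} {Δ} d ds sd) e =
  let eᵢ , eΔ = both-fresh (⊓-nothing⁻ Δᵢ Δ e)
      D , dD , c = thin* ds eΔ
  in _ , arg+ (Thin eᵢ d) dD (sd-≈ ≈ᶜ-refl (≈ᶜ-sym c) (sd-ext⁺ sd)) ,
     ≈ᶜ-trans (⊓-cong {Δᵢ , x ∶ []} ≈ᶜ-refl c) (⊓-ext {Δᵢ} {Δ} {x} {[]} {[]})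
  where
  both-fresh : Δᵢ x ≡ nothing ⊎ Δ x ≡ nothing → Δᵢ x ≡ nothing × Δ x ≡ nothing
  both-fresh (inj₁ e') = e' , proj₁ (sd x) e'
  both-fresh (inj₂ e') = proj₂ (sd x) e' , e'

record DupInv* (Δ : Basis) (x x₁ x₂ : Var) (N : Term) (τs : Inter) : Set where
  constructor dupInv*
  field
    {Δ'} : Basis
    {A B} : Inter
    {D} : Basis
    body : D ⊢* N ∶ τs
    body≈ : D ≈ᶜ ((Δ' , x₁ ∶ A) , x₂ ∶ B)
    basis≈ : Δ ≈ᶜ (Δ' , x ∶ (A ++ B))
    fresh₁ : Δ' x₁ ≡ nothing
    fresh₂ : (Δ' , x₁ ∶ A) x₂ ≡ nothing
    fresh : Δ' x ≡ nothing

invDup* : ∀ {Δ x x₁ x₂ N τs} → Δ ⊢* dup x x₁ x₂ N ∶ τs → DupInv* Δ x x₁ x₂ N τs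
invDup* {x = x} {x₁} {x₂} (arg₀ d) with invDup d
... | dupInv {Γ'} {a} {b} f₁ f₂ f d' c =
  let x₂≢x₁ , f₂' = ext-nothing⁻ Γ' {x₁} {x₂} {a} f₂ in
  dupInv* {A = []} {B = []} (arg₀ d')
    (≈ᶜ-trans (ᵀ-ext {Γ' , x₁ ∶ a} {x₂} {b}) (ext-cong (ᵀ-ext {Γ'} {x₁} {a}) (≈ᵢ-refl [])))
    (≈ᶜ-trans (ᵀ-cong c) (ᵀ-ext {Γ'} {x} {a ++ b}))
    (ᵀ-nothing Γ' f₁) (ext-nothing⁺ (Γ' ᵀ) {x₁} {x₂} {[]} x₂≢x₁ (ᵀ-nothing Γ' f₂')) (ᵀ-nothing Γ' f)
invDup* {x = x} {x₁} {x₂} (arg+ d ds sd) with invDup d | invDup* ds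
... | dupInv {Γᵢ} {a} {b} f₁ f₂ f dᵢ cᵢ | dupInv* {Δ'} {A} {B} dD cD cΔ g₁ g₂ g =
  let x₂≢x₁ , f₂' = ext-nothing⁻ Γᵢ {x₁} {x₂} {a} f₂
      sdΓ = sd-ext⁻ (sd-≈ cᵢ cΔ sd) f g
  in
  dupInv* {Δ' = Γᵢ ⊓ Δ'} {a ++ A} {b ++ B}
    (arg+ dᵢ dD (sd-≈ ≈ᶜ-refl (≈ᶜ-sym cD) (sd-ext⁺ (sd-ext⁺ sdΓ))))
    (≈ᶜ-trans (⊓-cong {(Γᵢ , x₁ ∶ a) , x₂ ∶ b} ≈ᶜ-refl cD)
      (≈ᶜ-trans (⊓-ext {Γᵢ , x₁ ∶ a} {Δ' , x₁ ∶ A} {x₂} {b} {B})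
        (ext-cong (⊓-ext {Γᵢ} {Δ'} {x₁} {a} {A}) (≈ᵢ-refl _))))
    (≈ᶜ-trans (⊓-cong cᵢ cΔ) (≈ᶜ-trans (⊓-ext {Γᵢ} {Δ'} {x} {a ++ b} {A ++ B})
       (ext-cong ≈ᶜ-refl (++-interchange a b A B))))
    (⊓-nothingˡ Γᵢ Δ' f₁) (ext-nothing⁺ (Γᵢ ⊓ Δ') {x₁} {x₂} {a ++ A} x₂≢x₁ (⊓-nothingˡ Γᵢ Δ' f₂'))
    (⊓-nothingˡ Γᵢ Δ' f)

var* : ∀ {Δ x α} → Δ ⊢* ` x ∶ α → Δ ≈ᶜ (∅ , x ∶ α)
var* {x = x} (arg₀ d) =
  ≈ᶜ-trans (ᵀ-cong (invVar d)) (≈ᶜ-trans (ᵀ-ext {∅} {x}) (ext-cong (λ _ → nothing) ≈-[]))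
var* {x = x} (arg+ {τ = τ} {τs} d ds _) =
  ≈ᶜ-trans (⊓-cong (invVar d) (var* ds))
    (≈ᶜ-trans (⊓-ext {∅} {∅} {x} {τ ∷ []} {τs}) (ext-cong (λ _ → nothing) (≈ᵢ-refl _)))

⊢*-++ : ∀ {D₁ D₂ N α β} → D₁ ⊢* N ∶ α → D₂ ⊢* N ∶ β →
        Σ Basis λ D → D ⊢* N ∶ (α ++ β) × D ≈ᶜ (D₁ ⊓ D₂)
⊢*-++ {D₂ = D₂} (arg₀ d) ds₂ = D₂ , ds₂ , ≈ᶜ-sym (⊓-ᵀˡ (sd-⊢ d ds₂))
⊢*-++ {D₂ = D₂} (arg+ {Δᵢ} {Δ} d ds sd) ds₂ with ⊢*-++ ds ds₂
... | D' , dD' , c =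
  _ , arg+ d dD' (sd-⊢ d dD') , ≈ᶜ-trans (⊓-cong {Δᵢ} ≈ᶜ-refl c) (⊓-assoc {Δᵢ} {Δ} {D₂})

dis-fv* : ∀ {Γ Δ N τs z} → DisjointDom Γ Δ → Δ ⊢* N ∶ τs → z ∈ fv N → Γ z ≡ nothing
dis-fv* {z = z} dis ds m with dis z
... | inj₁ e = e
... | inj₂ e = ⊥-elim (≡just⇒≢nothing (dom*-∈ ds m) e)

-- Subject expansion for the non-β rules other than γω≡: each contractum
-- derivation is inverted and the rules are re-applied in the order of
-- the redex.  The bases agree up to reordering of extensions.

expand-ω-appL : ∀ {x M N Γ σ} → Γ ⊢ x ⊙ (M · N) ∶ σ → Γ ⊢ (x ⊙ M) · N ∶ σ
expand-ω-appL {x} d with invEra d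
... | eraInv fr d' c with invApp d'
...   | appInv {Γ₁} {Γ₂} d₁ d₂ dis c' =
  let fr₁ , fr₂ = ⊎-nothing⁻ Γ₁ Γ₂ (≈ᵐ-nothing→ (c' x) fr) in
  Conv (→E (Thin fr₁ d₁) d₂ (dis-extˡ⁺ dis fr₂))
       (≈ᶜ-sym (≈ᶜ-trans c (≈ᶜ-trans (ext-cong c' (≈ᵢ-refl [])) (≈ᶜ-sym (ext-⊎ˡ {Γ₁} {Γ₂} {x} {[]})))))
       (≈ˢ-refl _)

expand-ω-appR : ∀ {x M N Γ σ} → Γ ⊢ x ⊙ (M · N) ∶ σ → Γ ⊢ M · (x ⊙ N) ∶ σ
expand-ω-appR {x} d with invEra d
... | eraInv fr d' c with invApp d'
...   | appInv {Γ₁} {Γ₂} d₁ d₂ dis c' =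
  let fr₁ , fr₂ = ⊎-nothing⁻ Γ₁ Γ₂ (≈ᵐ-nothing→ (c' x) fr)
      D , dD , cD = thin* d₂ fr₂
  in
  Conv (→E d₁ dD (dis-≈ʳ (≈ᶜ-sym cD) (dis-extʳ⁺ dis fr₁)))
       (≈ᶜ-sym (≈ᶜ-trans c (≈ᶜ-trans (ext-cong c' (≈ᵢ-refl []))
         (≈ᶜ-sym (≈ᶜ-trans (⊎-congʳ {Γ₁} cD) (ext-⊎ʳ {Γ₁} {Γ₂} {x} {[]} fr₁))))))
       (≈ˢ-refl _)

expand-ω-abs : ∀ {x y M Γ σ} → x ≢ y → Γ ⊢ y ⊙ (ƛ x ⇒ M) ∶ σ → Γ ⊢ ƛ x ⇒ (y ⊙ M) ∶ σ
expand-ω-abs {x} {y} x≢y d with invEra d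
... | eraInv fr d' c with invAbs d'
...   | absInv {Γ''} frx d'' t c' =
  let fry = ≈ᵐ-nothing→ (c' y) fr in
  Conv (→I (ext-nothing⁺ Γ'' x≢y frx)
           (Conv (Thin (ext-nothing⁺ Γ'' (≢-sym x≢y) fry) d'') (ext-swap x≢y) (≈ˢ-refl _)))
       (≈ᶜ-sym (≈ᶜ-trans c (ext-cong c' (≈ᵢ-refl []))))
       t

expand-γω : ∀ {x x₁ x₂ y M Γ σ} → y ≢ x₁ → y ≢ x₂ →
            Γ ⊢ y ⊙ dup x x₁ x₂ M ∶ σ → Γ ⊢ dup x x₁ x₂ (y ⊙ M) ∶ σ
expand-γω {x} {x₁} {x₂} {y} y≢x₁ y≢x₂ d with invEra d
... | eraInv {Γ'} fry d' c with invDup d'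
...   | dupInv {Γ''} {α} {β} f₁ f₂ f d'' c' =
  let y≢x = λ (e : y ≡ x) → ≡just⇒≢nothing (dom-∈ d' (here refl)) (subst (λ v → Γ' v ≡ nothing) e fry)
      fry'' = trans (sym (ext-there Γ'' (α ++ β) y≢x)) (≈ᵐ-nothing→ (c' y) fry)
      x₂≢x₁ , f₂' = ext-nothing⁻ Γ'' f₂
      thin = Thin (ext-nothing⁺ _ y≢x₂ (ext-nothing⁺ Γ'' y≢x₁ fry'')) d''
      thin' = Conv thin (≈ᶜ-trans (ext-swap (≢-sym y≢x₂)) (ext-cong (ext-swap (≢-sym y≢x₁)) (≈ᵢ-refl β)))
                   (≈ˢ-refl _)
  in
  Conv (Cont (ext-nothing⁺ Γ'' (≢-sym y≢x₁) f₁)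
             (ext-nothing⁺ _ x₂≢x₁ (ext-nothing⁺ Γ'' (≢-sym y≢x₂) f₂'))
             (ext-nothing⁺ Γ'' (≢-sym y≢x) f) thin')
       (≈ᶜ-sym (≈ᶜ-trans c (≈ᶜ-trans (ext-cong c' (≈ᵢ-refl [])) (ext-swap (≢-sym y≢x)))))
       (≈ˢ-refl _)

expand-γ-abs : ∀ {x x₁ x₂ y M Γ σ} → y ≢ x → x₁ ≢ y → x₂ ≢ y →
               Γ ⊢ ƛ y ⇒ dup x x₁ x₂ M ∶ σ → Γ ⊢ dup x x₁ x₂ (ƛ y ⇒ M) ∶ σ
expand-γ-abs {x} {x₁} {x₂} {y} y≢x x₁≢y x₂≢y d with invAbs d
... | absInv {Γ'} {α} fy d' t c with invDup d'
...   | dupInv {Γ''} {a} {b} f₁ f₂ f d'' c' =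
  let Γ''y = ≈ᵐ-sym (≈ᵐ-cast (sym (ext-here Γ' y α)) (sym (ext-there Γ'' (a ++ b) y≢x)) (c' y))
      Γ₃ = del y Γ''
      body≈ = ≈ᶜ-trans (ext-cong (ext-cong (split-at {Γ''} {y} {α} Γ''y) (≈ᵢ-refl a)) (≈ᵢ-refl b))
              (≈ᶜ-trans (ext-cong (ext-swap {Γ₃} {y} {x₁} {α} {a} (≢-sym x₁≢y)) (≈ᵢ-refl b))
                        (ext-swap {Γ₃ , x₁ ∶ a} {y} {x₂} {α} {b} (≢-sym x₂≢y)))
      abs = →I {x = y} {α = α}
              (ext-nothing⁺ _ {x₂} {y} {b} (≢-sym x₂≢y) (ext-nothing⁺ Γ₃ {x₁} {y} {a} (≢-sym x₁≢y) (del-here y Γ'')))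
              (Conv d'' body≈ (≈ˢ-refl _))
      x₂≢x₁ , f₂' = ext-nothing⁻ Γ'' {x₁} {x₂} {a} f₂
      cont = Cont (trans (del-there Γ'' x₁≢y) f₁)
                  (ext-nothing⁺ Γ₃ {x₁} {x₂} {a} x₂≢x₁ (trans (del-there Γ'' x₂≢y) f₂'))
                  (trans (del-there Γ'' (≢-sym y≢x)) f) abs
      basis≈ = ≈ᶜ-trans c (≈ᶜ-trans (del-fresh {Γ'} {y} fy)
                 (≈ᶜ-trans (≈ᶜ-sym (del-ext-same {Γ'} {y} {α}))
                   (≈ᶜ-trans (del-cong c') (del-ext {Γ''} {x} {y} {a ++ b} y≢x))))
  in Conv cont (≈ᶜ-sym basis≈) t

expand-γ-appL : ∀ {x x₁ x₂ M N Γ σ} → x₁ ∉ fv N → x₂ ∉ fv N →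
                Γ ⊢ dup x x₁ x₂ M · N ∶ σ → Γ ⊢ dup x x₁ x₂ (M · N) ∶ σ
expand-γ-appL {x} {x₁} {x₂} x₁∉N x₂∉N d with invApp d
... | appInv {Γ₁} {Γ₂} d₁ d₂ dis c with invDup d₁
...   | dupInv {Γ''} {a} {b} f₁ f₂ f d'' c' =
  let Γ₂x₁ = dom*-∉ d₂ x₁∉N
      Γ₂x₂ = dom*-∉ d₂ x₂∉N
      Γ₂x = [ (λ e → ⊥-elim (≡just⇒≢nothing (dom-∈ d₁ (here refl)) e)) , (λ e → e) ]′ (dis x)
      dis'' = dis-extˡ⁻ (dis-≈ˡ c' dis) f
      app = Conv (→E d'' d₂ (dis-extˡ⁺ {x = x₂} {α = b} (dis-extˡ⁺ {x = x₁} {α = a} dis'' Γ₂x₁) Γ₂x₂))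
                 (≈ᶜ-trans (ext-⊎ˡ {Γ'' , x₁ ∶ a} {Γ₂} {x₂} {b}) (ext-cong (ext-⊎ˡ {Γ''} {Γ₂} {x₁} {a}) (≈ᵢ-refl b)))
                 (≈ˢ-refl _)
      x₂≢x₁ , f₂' = ext-nothing⁻ Γ'' {x₁} {x₂} {a} f₂
      cont = Cont (trans (⊎-nothingˡ Γ'' Γ₂ f₁) Γ₂x₁)
                  (ext-nothing⁺ (Γ'' ⊎ᶜ Γ₂) {x₁} {x₂} {a} x₂≢x₁ (trans (⊎-nothingˡ Γ'' Γ₂ f₂') Γ₂x₂))
                  (trans (⊎-nothingˡ Γ'' Γ₂ f) Γ₂x) app
  in Conv cont (≈ᶜ-sym (≈ᶜ-trans c (≈ᶜ-trans (⊎-congˡ c') (ext-⊎ˡ {Γ''} {Γ₂} {x} {a ++ b})))) (≈ˢ-refl _)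

expand-γ-appR : ∀ {x x₁ x₂ M N Γ σ} → x₁ ∉ fv M → x₂ ∉ fv M →
                Γ ⊢ M · dup x x₁ x₂ N ∶ σ → Γ ⊢ dup x x₁ x₂ (M · N) ∶ σ
expand-γ-appR {x} {x₁} {x₂} x₁∉M x₂∉M d with invApp d
... | appInv {Γ₁} {Γ₂} d₁ d₂ dis c with invDup* d₂
...   | dupInv* {Δ''} {A} {B} dD cD cΔ g₁ g₂ g =
  let Γ₁x₁ = dom-∉ d₁ x₁∉M
      Γ₁x₂ = dom-∉ d₁ x₂∉M
      Γ₁x = [ (λ e → e) , (λ e → ⊥-elim (≡just⇒≢nothing (dom*-∈ d₂ (here refl)) e)) ]′ (dis x)
      dis'' = dis-extʳ⁻ (dis-≈ʳ cΔ dis) g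
      disD = dis-≈ʳ (≈ᶜ-sym cD) (dis-extʳ⁺ {x = x₂} {α = B} (dis-extʳ⁺ {x = x₁} {α = A} dis'' Γ₁x₁) Γ₁x₂)
      app = Conv (→E d₁ dD disD)
                 (≈ᶜ-trans (⊎-congʳ {Γ₁} cD) (≈ᶜ-trans (ext-⊎ʳ {Γ₁} {Δ'' , x₁ ∶ A} {x₂} {B} Γ₁x₂)
                    (ext-cong (ext-⊎ʳ {Γ₁} {Δ''} {x₁} {A} Γ₁x₁) (≈ᵢ-refl B))))
                 (≈ˢ-refl _)
      x₂≢x₁ , g₂' = ext-nothing⁻ Δ'' {x₁} {x₂} {A} g₂
      cont = Cont (trans (⊎-nothingˡ Γ₁ Δ'' Γ₁x₁) g₁)
                  (ext-nothing⁺ (Γ₁ ⊎ᶜ Δ'') {x₁} {x₂} {A} x₂≢x₁ (trans (⊎-nothingˡ Γ₁ Δ'' Γ₁x₂) g₂'))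
                  (trans (⊎-nothingˡ Γ₁ Δ'' Γ₁x) g) app
  in Conv cont (≈ᶜ-sym (≈ᶜ-trans c (≈ᶜ-trans (⊎-congʳ {Γ₁} cΔ) (ext-⊎ʳ {Γ₁} {Δ''} {x} {A ++ B} Γ₁x)))) (≈ˢ-refl _)

-- The substitution relation Subst is not restricted to
-- well-formed terms, so the invariants of Λ_® that the expansion proof
-- needs are isolated in  Lin z T : "T uses z linearly", i.e. no
-- application shares z between its two sides, an erasure or duplication
-- of z is not followed by further free occurrences of z, and the copies
-- introduced by a duplication are used linearly themselves.

Lin : Var → Term → Set
Lin z (` y) = ⊤
Lin z (ƛ y ⇒ M) = z ≢ y → Lin z M
Lin z (M · P) = (z ∈ fv M → z ∉ fv P) × (z ∈ fv P → z ∉ fv M) × Lin z M × Lin z P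
Lin z (y ⊙ M) = (y ≡ z → z ∉ fv M) × Lin z M
Lin z (dup y y₁ y₂ M) = (y ≡ z → (z ∉ remove y₁ (remove y₂ (fv M))) × Lin y₁ M × Lin y₂ M) ×
                        (z ≢ y₁ → z ≢ y₂ → Lin z M)

AllLin : Term → Set
AllLin T = ∀ z → Lin z T

wf⇒AllLin : ∀ {T} → WF T → AllLin T
wf⇒AllLin wf-var z = tt
wf⇒AllLin (wf-abs w _) z = λ _ → wf⇒AllLin w z
wf⇒AllLin (wf-app w₁ w₂ dis) z = dis , (λ m m' → dis m' m) , wf⇒AllLin w₁ z , wf⇒AllLin w₂ z
wf⇒AllLin (wf-era {x} {M} w x∉) z = (λ e → subst (λ v → v ∉ fv M) e x∉) , wf⇒AllLin w z
wf⇒AllLin (wf-dup {x} {x₁} {x₂} {M} w _ _ _ x∉) z =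
  (λ e → subst (λ v → v ∉ remove x₁ (remove x₂ (fv M))) e x∉ , wf⇒AllLin w x₁ , wf⇒AllLin w x₂) ,
  (λ _ _ → wf⇒AllLin w z)

∉⇒Lin : ∀ {z} T → z ∉ fv T → Lin z T
∉⇒Lin (` x) _ = tt
∉⇒Lin (ƛ y ⇒ M) z∉ = λ z≢y → ∉⇒Lin M (λ m → z∉ (∈-remove⁺ (fv M) m z≢y))
∉⇒Lin (M · P) z∉ =
  (λ m → ⊥-elim (z∉ (∈-++⁺ˡ m))) , (λ m → ⊥-elim (z∉ (∈-++⁺ʳ (fv M) m))) ,
  ∉⇒Lin M (λ m → z∉ (∈-++⁺ˡ m)) , ∉⇒Lin P (λ m → z∉ (∈-++⁺ʳ (fv M) m))
∉⇒Lin (y ⊙ M) z∉ = (λ _ m → z∉ (there m)) , ∉⇒Lin M (λ m → z∉ (there m))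
∉⇒Lin (dup y y₁ y₂ M) z∉ =
  (λ y≡z → ⊥-elim (z∉ (here (sym y≡z)))) ,
  (λ z≢y₁ z≢y₂ → ∉⇒Lin M (λ m → z∉ (there (∈-remove₂⁺ (fv M) m z≢y₂ z≢y₁))))

Lin-ren : ∀ {f} → Inj f → ∀ {z} T → Lin z T → Lin (f z) (ren f T)
Lin-ren inj (` x) l = tt
Lin-ren {f} inj (ƛ y ⇒ M) l = λ fz≢fy → Lin-ren inj M (l (λ z≡y → fz≢fy (cong f z≡y)))
Lin-ren {f} inj {z} (M · P) (l₁ , l₂ , lM , lP) =
  (λ m m' → l₁ (back M m) (back P m')) , (λ m m' → l₂ (back P m) (back M m')) ,
  Lin-ren inj M lM , Lin-ren inj P lP
  where
  back : ∀ T → f z ∈ fv (ren f T) → z ∈ fv T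
  back T m = ∈-map-inj inj (fv T) (subst (f z ∈_) (fv-ren inj T) m)
Lin-ren {f} inj {z} (y ⊙ M) (l₁ , lM) =
  (λ e m → l₁ (inj e) (∈-map-inj inj (fv M) (subst (f z ∈_) (fv-ren inj M) m))) , Lin-ren inj M lM
Lin-ren {f} inj {z} (dup y y₁ y₂ M) (l₁ , l₂) =
  (λ e → let (z∉ , ly₁ , ly₂) = l₁ (inj e) in
         (λ m → z∉ (∈-map-inj inj _ (subst (f z ∈_) (fv-ren-dup inj y₁ y₂ M) m)))
         , Lin-ren inj M ly₁ , Lin-ren inj M ly₂) ,
  (λ n₁ n₂ → Lin-ren inj M (l₂ (λ e → n₁ (cong f e)) (λ e → n₂ (cong f e))))

AllLin-ren : ∀ {f} → Inj f → ∀ T → AllLin T → AllLin (ren f T)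
AllLin-ren {f} inj T al z with z ∈? fv (ren f T)
... | no z∉ = ∉⇒Lin _ z∉
... | yes m with ∈-fv-ren⁻ inj T m
...   | w , _ , refl = Lin-ren inj T (al w)

Lin-erasures : ∀ vs {z M} → z ∉ vs → Lin z M → Lin z (erasures vs M)
Lin-erasures [] z∉ l = l
Lin-erasures (v ∷ vs) z∉ l = (λ e → ⊥-elim (z∉ (here (sym e)))) , Lin-erasures vs (λ m → z∉ (there m)) l

fv-dups : ∀ (f g : Var → Var) vs T {v} → v ∈ fv (dups vs (map f vs) (map g vs) T) →
          v ∈ vs ⊎ (v ∈ fv T × v ∉ map f vs × v ∉ map g vs)
fv-dups f g [] T m = inj₂ (m , (λ ()) , (λ ()))
fv-dups f g (w ∷ vs) T (here e) = inj₁ (here e)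
fv-dups f g (w ∷ vs) T (there m) =
  let (m' , v≢gw , v≢fw) = ∈-remove₂⁻ _ m
  in step v≢fw v≢gw (fv-dups f g vs T m')
  where
  step : ∀ {v} → v ≢ f w → v ≢ g w → v ∈ vs ⊎ (v ∈ fv T × v ∉ map f vs × v ∉ map g vs) →
         v ∈ (w ∷ vs) ⊎ (v ∈ fv T × v ∉ map f (w ∷ vs) × v ∉ map g (w ∷ vs))
  step _ _ (inj₁ m) = inj₁ (there m)
  step v≢fw v≢gw (inj₂ (m , v∉f , v∉g)) =
    inj₂ (m , (λ { (here e) → v≢fw e ; (there q) → v∉f q }) , (λ { (here e) → v≢gw e ; (there q) → v∉g q }))

Lin-dups : ∀ (f g : Var → Var) vs T {z} → z ∉ vs → (z ∉ map f vs → z ∉ map g vs → Lin z T) →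
           Lin z (dups vs (map f vs) (map g vs) T)
Lin-dups f g [] T z∉ h = h (λ ()) (λ ())
Lin-dups f g (w ∷ vs) T z∉ h =
  (λ e → ⊥-elim (z∉ (here (sym e)))) ,
  (λ n₁ n₂ → Lin-dups f g vs T (λ m → z∉ (there m))
     (λ a b → h (λ { (here e) → n₁ e ; (there q) → a q }) (λ { (here e) → n₂ e ; (there q) → b q })))

dups-ren : ∀ {f g} → Inj f → Inj g → ∀ N R →
           dups (fv N) (fv (ren f N)) (fv (ren g N)) R ≡ dups (fv N) (map f (fv N)) (map g (fv N)) R
dups-ren injf injg N R = cong₂ (λ l₁ l₂ → dups (fv N) l₁ l₂ R) (fv-ren injf N) (fv-ren injg N)

module Copies x x₁ x₂ M N {f g} (fp : FreshPair f g (vars (dup x x₁ x₂ M) ++ vars N)) where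

  injf : Inj f
  injf = proj₁ fp

  injg : Inj g
  injg = proj₁ (proj₂ fp)

  Avoid : List Var
  Avoid = vars (dup x x₁ x₂ M) ++ vars N

  f-avoids : ∀ v → f v ∉ Avoid
  f-avoids = proj₁ (proj₂ (proj₂ fp))

  g-avoids : ∀ v → g v ∉ Avoid
  g-avoids = proj₁ (proj₂ (proj₂ (proj₂ fp)))

  fresh-f : ∀ {w} → w ∈ fv (ren f N) → w ∉ Avoid
  fresh-f m a with ∈-fv-ren⁻ injf N m
  ... | v , _ , refl = f-avoids v a

  fresh-g : ∀ {w} → w ∈ fv (ren g N) → w ∉ Avoid
  fresh-g m a with ∈-fv-ren⁻ injg N m
  ... | v , _ , refl = g-avoids v a

  f≢g : ∀ v w → f v ≢ g w
  f≢g = proj₂ (proj₂ (proj₂ (proj₂ fp)))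

  apart : ∀ {w} → w ∈ fv (ren f N) → w ∉ fv (ren g N)
  apart m m' with ∈-fv-ren⁻ injf N m | ∈-fv-ren⁻ injg N m'
  ... | v , _ , refl | v' , _ , e = f≢g v v' e

  x₁∉N₁ : x₁ ∉ fv (ren f N)
  x₁∉N₁ q = fresh-f q (there (here refl))

  x₁∉N₂ : x₁ ∉ fv (ren g N)
  x₁∉N₂ q = fresh-g q (there (here refl))

  x₂∉N₁ : x₂ ∉ fv (ren f N)
  x₂∉N₁ q = fresh-f q (there (there (here refl)))

  x₂∉N₂ : x₂ ∉ fv (ren g N)
  x₂∉N₂ q = fresh-g q (there (there (here refl)))

  N-avoids-f : ∀ {v w} → w ∈ fv N → f v ≢ w
  N-avoids-f {v} m e = f-avoids v
    (subst (_∈ Avoid) (sym e) (there (there (there (∈-++⁺ʳ (vars M) (fv⊆vars N m))))))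

  N-avoids-g : ∀ {v w} → w ∈ fv N → g v ≢ w
  N-avoids-g {v} m e = g-avoids v
    (subst (_∈ Avoid) (sym e) (there (there (there (∈-++⁺ʳ (vars M) (fv⊆vars N m))))))

  f≢x₂ : ∀ v → f v ≢ x₂
  f≢x₂ v e = f-avoids v (subst (_∈ Avoid) (sym e) (there (there (here refl))))

  g≢x₂ : ∀ v → g v ≢ x₂
  g≢x₂ v e = g-avoids v (subst (_∈ Avoid) (sym e) (there (there (here refl))))

mutual
  subst-fv : ∀ {M N x R v} → Subst M N x R → Lin x M → AllLin N →
             v ∈ fv R → (v ∈ fv M × v ≢ x) ⊎ v ∈ fv N
  subst-fv s-var _ _ m = inj₂ m
  subst-fv (s-abs {y} {M} y≢x _ d) l al m with ∈-remove⁻ _ m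
  ... | m' , v≢y with subst-fv d (l (≢-sym y≢x)) al m'
  ...   | inj₁ (mM , v≢x) = inj₁ (∈-remove⁺ (fv M) mM v≢y , v≢x)
  ...   | inj₂ mN = inj₂ mN
  subst-fv {v = v} (s-appL {M} {P} {R = R} x∈M d) (x∉P , _ , lM , _) al m with ∈-++⁻ (fv R) m
  ... | inj₂ mP = inj₁ (∈-++⁺ʳ (fv M) mP , λ v≡x → x∉P x∈M (subst (_∈ fv P) v≡x mP))
  ... | inj₁ mR with subst-fv d lM al mR
  ...   | inj₁ (mM , v≢x) = inj₁ (∈-++⁺ˡ mM , v≢x)
  ...   | inj₂ mN = inj₂ mN
  subst-fv (s-appR {M} {P} x∈P d) (_ , x∉M , _ , lP) al m with ∈-++⁻ (fv M) m
  ... | inj₁ mM = inj₁ (∈-++⁺ˡ mM , λ v≡x → x∉M x∈P (subst (_∈ fv M) v≡x mM))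
  ... | inj₂ mR with subst-fv d lP al mR
  ...   | inj₁ (mP , v≢x) = inj₁ (∈-++⁺ʳ (fv M) mP , v≢x)
  ...   | inj₂ mN = inj₂ mN
  subst-fv (s-era y≢x d) _ al (here refl) = inj₁ (here refl , y≢x)
  subst-fv (s-era y≢x d) (_ , lM) al (there m) with subst-fv d lM al m
  ... | inj₁ (mM , v≢x) = inj₁ (there mM , v≢x)
  ... | inj₂ mN = inj₂ mN
  subst-fv {v = v} (s-era≡ {M} {N}) (x∉M , _) al m with ∈-++⁻ (fv N) (subst (v ∈_) (fv-erasures (fv N) M) m)
  ... | inj₁ mN = inj₂ mN
  ... | inj₂ mM = inj₁ (there mM , λ v≡x → x∉M refl (subst (_∈ fv M) v≡x mM))
  subst-fv (s-dup y≢x _ _ _ _ d) _ al (here refl) = inj₁ (here refl , y≢x)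
  subst-fv (s-dup {M = M} _ y₁≢x y₂≢x _ _ d) (_ , lM) al (there m) with ∈-remove₂⁻ _ m
  ... | m' , v≢y₂ , v≢y₁ with subst-fv d (lM (≢-sym y₁≢x) (≢-sym y₂≢x)) al m'
  ...   | inj₁ (mM , v≢x) = inj₁ (there (∈-remove₂⁺ (fv M) mM v≢y₂ v≢y₁) , v≢x)
  ...   | inj₂ mN = inj₂ mN
  subst-fv {v = v} (s-dup≡ {x₁} {x₂} {M} {N} {x} {R₁} {R₂} f g fp d₁ d₂) (self , _) al m
    with fv-dups f g (fv N) R₂ (subst (λ T → v ∈ fv T) (dups-ren injf injg N R₂) m) | self refl
    where open Copies x x₁ x₂ M N fp
  ... | inj₁ mN | _ = inj₂ mN
  ... | inj₂ (mR₂ , v∉f , v∉g) | x∉ , lx₁ , lx₂ = inj₁ (fv-R₂ mR₂)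
    where
    open Copies x x₁ x₂ M N fp
    alN₁ : AllLin (ren f N)
    alN₁ = AllLin-ren injf N al
    fv-R₂ : v ∈ fv R₂ → v ∈ fv (dup x x₁ x₂ M) × v ≢ x
    fv-R₂ mR₂ with subst-fv d₂ (subst-Lin d₁ lx₁ lx₂ alN₁ x₂∉N₁) (AllLin-ren injg N al) mR₂
    ... | inj₂ mN₂ = ⊥-elim (v∉g (subst (v ∈_) (fv-ren injg N) mN₂))
    ... | inj₁ (mR₁ , v≢x₂) with subst-fv d₁ lx₁ alN₁ mR₁
    ...   | inj₂ mN₁ = ⊥-elim (v∉f (subst (v ∈_) (fv-ren injf N) mN₁))
    ...   | inj₁ (mM , v≢x₁) =
      let m' = ∈-remove₂⁺ (fv M) mM v≢x₂ v≢x₁ in there m' , λ v≡x → x∉ (subst (_∈ _) v≡x m')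

  subst-∉ : ∀ {M N x R} → Subst M N x R → Lin x M → AllLin N → x ∉ fv N → x ∉ fv R
  subst-∉ d l al x∉N m = [ (λ p → proj₂ p refl) , x∉N ]′ (subst-fv d l al m)

  subst-Lin : ∀ {M N x R z} → Subst M N x R → Lin x M → Lin z M → AllLin N → z ∉ fv N → Lin z R
  subst-Lin {z = z} s-var _ _ al _ = al z
  subst-Lin (s-abs y≢x _ d) lx lz al z∉N = λ z≢y → subst-Lin d (lx (≢-sym y≢x)) (lz z≢y) al z∉N
  subst-Lin (s-appL _ d) (_ , _ , lxM , _) (lz₁ , lz₂ , lzM , lzP) al z∉N =
    (λ m → [ (λ p → lz₁ (proj₁ p)) , (λ mN → ⊥-elim (z∉N mN)) ]′ (subst-fv d lxM al m)) ,
    (λ m m' → [ (λ p → lz₂ m (proj₁ p)) , z∉N ]′ (subst-fv d lxM al m')) ,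
    subst-Lin d lxM lzM al z∉N , lzP
  subst-Lin (s-appR _ d) (_ , _ , _ , lxP) (lz₁ , lz₂ , lzM , lzP) al z∉N =
    (λ m m' → [ (λ p → lz₁ m (proj₁ p)) , z∉N ]′ (subst-fv d lxP al m')) ,
    (λ m → [ (λ p → lz₂ (proj₁ p)) , (λ mN → ⊥-elim (z∉N mN)) ]′ (subst-fv d lxP al m)) ,
    lzM , subst-Lin d lxP lzP al z∉N
  subst-Lin (s-era _ d) (_ , lxM) (lz₁ , lzM) al z∉N =
    (λ e m → [ (λ p → lz₁ e (proj₁ p)) , z∉N ]′ (subst-fv d lxM al m)) , subst-Lin d lxM lzM al z∉N
  subst-Lin (s-era≡ {M} {N}) _ (_ , lzM) _ z∉N = Lin-erasures (fv N) z∉N lzM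
  subst-Lin (s-dup {M = M} {x = x} _ y₁≢x y₂≢x y₁∉N y₂∉N d) (_ , lx) (lz₁ , lz₂) al z∉N =
    (λ e → let (z∉ , ly₁ , ly₂) = lz₁ e in
      (λ m → let (m' , z≢y₂ , z≢y₁) = ∈-remove₂⁻ _ m in
             [ (λ p → z∉ (∈-remove₂⁺ (fv M) (proj₁ p) z≢y₂ z≢y₁)) , z∉N ]′ (subst-fv d lxM al m')) ,
      subst-Lin d lxM ly₁ al y₁∉N , subst-Lin d lxM ly₂ al y₂∉N) ,
    (λ z≢y₁ z≢y₂ → subst-Lin d lxM (lz₂ z≢y₁ z≢y₂) al z∉N)
    where
    lxM : Lin x M
    lxM = lx (≢-sym y₁≢x) (≢-sym y₂≢x)
  subst-Lin {z = z} (s-dup≡ {x₁} {x₂} {M} {N} {x} {R₁} {R₂} f g fp d₁ d₂) (self , _) (_ , lz) al z∉N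
    with self refl
  ... | _ , lx₁ , lx₂ = subst (Lin z) (sym (dups-ren injf injg N R₂)) (Lin-dups f g (fv N) R₂ z∉N lin-R₂)
    where
    open Copies x x₁ x₂ M N fp
    alN₁ : AllLin (ren f N)
    alN₁ = AllLin-ren injf N al
    alN₂ : AllLin (ren g N)
    alN₂ = AllLin-ren injg N al
    lR₁ : Lin x₂ R₁
    lR₁ = subst-Lin d₁ lx₁ lx₂ alN₁ x₂∉N₁
    lin-R₂ : z ∉ map f (fv N) → z ∉ map g (fv N) → Lin z R₂
    lin-R₂ z∉f z∉g with ≡-or-≢ z x₁ | ≡-or-≢ z x₂
    ... | inj₁ refl | _ = ∉⇒Lin R₂ (λ m → [ (λ p → subst-∉ d₁ lx₁ alN₁ x₁∉N₁ (proj₁ p)) , x₁∉N₂ ]′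
                                             (subst-fv d₂ lR₁ alN₂ m))
    ... | inj₂ _ | inj₁ refl = ∉⇒Lin R₂ (subst-∉ d₂ lR₁ alN₂ x₂∉N₂)
    ... | inj₂ z≢x₁ | inj₂ z≢x₂ =
      subst-Lin d₂ lR₁ (subst-Lin d₁ lx₁ (lz z≢x₁ z≢x₂) alN₁ (∉-fv-ren injf N z∉f)) alN₂ (∉-fv-ren injg N z∉g)

_∘ᶠ_ : Basis → (Var → Var) → Basis
(Γ ∘ᶠ f) v = Γ (f v)

module Renaming {f : Var → Var} (inj : Inj f) where

  ext-∘ᶠ : ∀ Γ y α v → (Γ , f y ∶ α) (f v) ≡ ((Γ ∘ᶠ f) , y ∶ α) v
  ext-∘ᶠ Γ y α v with ≡-or-≢ v y
  ... | inj₁ refl = trans (ext-here Γ (f v) α) (sym (ext-here (Γ ∘ᶠ f) v α))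
  ... | inj₂ v≢y = trans (ext-there Γ α (λ e → v≢y (inj e))) (sym (ext-there (Γ ∘ᶠ f) α v≢y))

  ∘ᶠ-ext : ∀ {Γ y α} → ((Γ , f y ∶ α) ∘ᶠ f) ≈ᶜ ((Γ ∘ᶠ f) , y ∶ α)
  ∘ᶠ-ext {Γ} {y} {α} v = ≡⇒≈ᵐ (ext-∘ᶠ Γ y α v)

  ∘ᶠ-cong : ∀ {Γ Γ'} → Γ ≈ᶜ Γ' → (Γ ∘ᶠ f) ≈ᶜ (Γ' ∘ᶠ f)
  ∘ᶠ-cong p v = p (f v)

  mutual
    ⊢-unren : ∀ N {Γ σ} → Γ ⊢ ren f N ∶ σ → (Γ ∘ᶠ f) ⊢ N ∶ σ
    ⊢-unren (` y) d = Conv Ax (λ v → ≈ᵐ-sym (≈ᵐ-cast refl (sym (ext-∘ᶠ ∅ y _ v)) (invVar d (f v)))) (≈ˢ-refl _)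
    ⊢-unren (ƛ y ⇒ N) d with invAbs d
    ... | absInv fr d' t c = Conv (→I fr (Conv (⊢-unren N d') ∘ᶠ-ext (≈ˢ-refl _))) (≈ᶜ-sym (∘ᶠ-cong c)) t
    ⊢-unren (N₁ · N₂) d with invApp d
    ... | appInv {Γ₁} {Γ₂} d₁ d₂ dis c with ⊢*-unren N₂ d₂
    ...   | D , dD , cD =
      Conv (→E (⊢-unren N₁ d₁) dD (dis-≈ʳ (≈ᶜ-sym cD) (λ v → dis (f v))))
           (≈ᶜ-trans (⊎-congʳ {Γ₁ ∘ᶠ f} cD)
             (λ v → ≈ᵐ-trans (⊎-cong-at {Γ₁} {Γ₁ ∘ᶠ f} {Γ₂} {Γ₂ ∘ᶠ f} {v} {f v} ≈ᵐ-refl ≈ᵐ-refl)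
                             (≈ᵐ-sym (c (f v)))))
           (≈ˢ-refl _)
    ⊢-unren (x ⊙ N) d with invEra d
    ... | eraInv {Γ'} fr d' c =
      Conv (Thin fr (⊢-unren N d')) (≈ᶜ-sym (≈ᶜ-trans (∘ᶠ-cong c) (∘ᶠ-ext {Γ'} {x} {[]}))) (≈ˢ-refl _)
    ⊢-unren (dup z x y N) d with invDup d
    ... | dupInv {Γ'} {α} {β} f₁ f₂ f₃ d' c =
      Conv (Cont f₁ (trans (sym (ext-∘ᶠ Γ' x α y)) f₂) f₃
             (Conv (⊢-unren N d')
                   (≈ᶜ-trans (∘ᶠ-ext {Γ' , f x ∶ α} {y} {β}) (ext-cong (∘ᶠ-ext {Γ'} {x} {α}) (≈ᵢ-refl β)))
                   (≈ˢ-refl _)))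
           (≈ᶜ-sym (≈ᶜ-trans (∘ᶠ-cong c) (∘ᶠ-ext {Γ'} {z} {α ++ β}))) (≈ˢ-refl _)

    ⊢*-unren : ∀ N {Δ τs} → Δ ⊢* ren f N ∶ τs → Σ Basis λ D → D ⊢* N ∶ τs × D ≈ᶜ (Δ ∘ᶠ f)
    ⊢*-unren N (arg₀ {Δ₀} d) = _ , arg₀ (⊢-unren N d) , (λ v → ᵀ-cong-at {Δ₀} {Δ₀ ∘ᶠ f} {v} {f v} ≈ᵐ-refl)
    ⊢*-unren N (arg+ {Δᵢ} {Δ} d ds sd) with ⊢*-unren N ds
    ... | D , dD , cD =
      _ , arg+ (⊢-unren N d) dD (sd-≈ ≈ᶜ-refl (≈ᶜ-sym cD) (λ v → sd (f v))) ,
      ≈ᶜ-trans (⊓-cong {Δᵢ ∘ᶠ f} ≈ᶜ-refl cD)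
        (λ v → ⊓-cong-at {Δᵢ} {Δᵢ ∘ᶠ f} {Δ} {Δ ∘ᶠ f} {v} {f v} ≈ᵐ-refl ≈ᵐ-refl)

  record Transported (Γ Γ' : Basis) : Set where
    constructor transported
    field
      at-image : ∀ v → Γ' (f v) ≈ᵐ Γ v
      in-image : ∀ z {a} → Γ' z ≡ just a → ∃ λ v → z ≡ f v
  open Transported

  transported-ext : ∀ {Γ Γ' x α} → Transported Γ Γ' → Transported (Γ , x ∶ α) (Γ' , f x ∶ α)
  transported-ext {Γ} {Γ'} {x} {α} (transported p q) = transported at in'
    where
    at : ∀ v → (Γ' , f x ∶ α) (f v) ≈ᵐ (Γ , x ∶ α) v
    at v with ≡-or-≢ v x
    ... | inj₁ refl = ≈ᵐ-by (ext-here Γ' (f v) α) (ext-here Γ v α)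
    ... | inj₂ v≢x = ≈ᵐ-cast (ext-there Γ' α (λ e → v≢x (inj e))) (ext-there Γ α v≢x) (p v)
    in' : ∀ z {a} → (Γ' , f x ∶ α) z ≡ just a → ∃ λ v → z ≡ f v
    in' z e with ≡-or-≢ z (f x)
    ... | inj₁ refl = x , refl
    ... | inj₂ z≢fx = q z (trans (sym (ext-there Γ' α z≢fx)) e)

  transported-split : ∀ {Γ Γ' x α} → Transported (Γ , x ∶ α) Γ' → Γ x ≡ nothing →
                      Transported Γ (del (f x) Γ') × Γ' ≈ᶜ (del (f x) Γ' , f x ∶ α)
  transported-split {Γ} {Γ'} {x} {α} (transported p q) Γx =
    transported at (λ z e → q z (del-just⁻ {f x} {Γ'} {z} e)) ,
    split-at (≈ᵐ-trans (p x) (≡⇒≈ᵐ (ext-here Γ x α)))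
    where
    at : ∀ v → del (f x) Γ' (f v) ≈ᵐ Γ v
    at v with ≡-or-≢ v x
    ... | inj₁ refl = ≈ᵐ-by (del-here (f v) Γ') Γx
    ... | inj₂ v≢x = ≈ᵐ-cast (del-there Γ' (λ e → v≢x (inj e))) (sym (ext-there Γ α v≢x)) (p v)

  transported-fresh : ∀ {Γ Γ' x} → Transported Γ Γ' → Γ x ≡ nothing → Γ' (f x) ≡ nothing
  transported-fresh r Γx = ≈ᵐ-nothing← (at-image r _) Γx

  transported-dis : ∀ {Γ Γ' Δ Δ'} → Transported Γ Γ' → Transported Δ Δ' →
                    DisjointDom Γ Δ → DisjointDom Γ' Δ'
  transported-dis {Γ' = Γ'} r s dis z with maybe-case (Γ' z)
  ... | inj₁ e = inj₁ e
  ... | inj₂ (a , e) with in-image r z e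
  ...   | v , refl with dis v
  ...     | inj₁ e' = ⊥-elim (just≢nothing (trans (sym e) (transported-fresh r e')))
  ...     | inj₂ e' = inj₂ (transported-fresh s e')

  transported-⊎ : ∀ {Γ Γ' Δ Δ'} → Transported Γ Γ' → Transported Δ Δ' → Transported (Γ ⊎ᶜ Δ) (Γ' ⊎ᶜ Δ')
  transported-⊎ {Γ} {Γ'} {Δ} {Δ'} r s =
    transported (λ v → ⊎-cong-at {Γ} {Γ'} {Δ} {Δ'} (at-image r v) (at-image s v)) in'
    where
    in' : ∀ z {a} → (Γ' ⊎ᶜ Δ') z ≡ just a → ∃ λ v → z ≡ f v
    in' z e with maybe-case (Γ' z)
    ... | inj₂ (_ , e') = in-image r z e'
    ... | inj₁ e' = in-image s z (trans (sym (⊎-nothingˡ Γ' Δ' e')) e)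

  transported-⊓ : ∀ {Γ Γ' Δ Δ'} → Transported Γ Γ' → Transported Δ Δ' → Transported (Γ ⊓ Δ) (Γ' ⊓ Δ')
  transported-⊓ {Γ} {Γ'} {Δ} {Δ'} r s =
    transported (λ v → ⊓-cong-at {Γ} {Γ'} {Δ} {Δ'} (at-image r v) (at-image s v))
                (λ z e → in-image r z (proj₂ (⊓-just⁻ Γ' Δ' e)))

  transported-ᵀ : ∀ {Γ Γ'} → Transported Γ Γ' → Transported (Γ ᵀ) (Γ' ᵀ)
  transported-ᵀ {Γ} {Γ'} r =
    transported (λ v → ᵀ-cong-at {Γ} {Γ'} (at-image r v)) (λ z e → in-image r z (proj₂ (ᵀ-just⁻ Γ' e)))

  transported-sd : ∀ {A A' B B'} → Transported A A' → Transported B B' → SameDom A B → SameDom A' B'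
  transported-sd rA rB sd z = one rA rB sd z , one rB rA (sd-sym sd) z
    where
    one : ∀ {A A' B B'} → Transported A A' → Transported B B' → SameDom A B → ∀ z → A' z ≡ nothing → B' z ≡ nothing
    one {B' = B'} rA rB sd z e with maybe-case (B' z)
    ... | inj₁ e' = e'
    ... | inj₂ (b , eb) with in-image rB z eb
    ...   | v , refl = ⊥-elim (just≢nothing (trans (sym eb)
                          (transported-fresh rB (proj₁ (sd v) (≈ᵐ-nothing→ (at-image rA v) e)))))

  mutual
    ⊢-ren : ∀ {Γ N σ} → Γ ⊢ N ∶ σ → Σ Basis λ Γ' → Γ' ⊢ ren f N ∶ σ × Transported Γ Γ'
    ⊢-ren (Ax {x} {σ}) = _ , Ax , transported-ext (transported (λ _ → nothing) (λ _ ()))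
    ⊢-ren (→I {Γ} {x} {α} Γx d) with ⊢-ren d
    ... | Γ₁ , d₁ , r with transported-split r Γx
    ...   | r' , split = del (f x) Γ₁ , →I (del-here (f x) Γ₁) (Conv d₁ split (≈ˢ-refl _)) , r'
    ⊢-ren (→E d ds dis) with ⊢-ren d | ⊢*-ren ds
    ... | _ , d₁ , r | _ , ds₁ , s = _ , →E d₁ ds₁ (transported-dis r s dis) , transported-⊎ r s
    ⊢-ren (Cont {Γ} {x} {y} {z} {α} {β} Γx Γy Γz d) with ⊢-ren d
    ... | Γ₁ , d₁ , r with transported-split r Γy
    ...   | r₂ , split₂ with transported-split r₂ Γx
    ...     | r₃ , split₃ =
      _ , Cont (del-here (f x) _) (≈ᵐ-nothing→ (split₃ (f y)) (del-here (f y) Γ₁)) (transported-fresh r₃ Γz)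
               (Conv d₁ (≈ᶜ-trans split₂ (ext-cong split₃ (≈ᵢ-refl β))) (≈ˢ-refl _)) ,
      transported-ext r₃
    ⊢-ren (Thin Γx d) with ⊢-ren d
    ... | _ , d₁ , r = _ , Thin (transported-fresh r Γx) d₁ , transported-ext r
    ⊢-ren (Conv d p q) with ⊢-ren d
    ... | Γ₁ , d₁ , r = Γ₁ , Conv d₁ ≈ᶜ-refl q ,
                        transported (λ v → ≈ᵐ-trans (at-image r v) (p v)) (in-image r)

    ⊢*-ren : ∀ {Δ N τs} → Δ ⊢* N ∶ τs → Σ Basis λ Δ' → Δ' ⊢* ren f N ∶ τs × Transported Δ Δ'
    ⊢*-ren (arg₀ d) with ⊢-ren d
    ... | _ , d₁ , r = _ , arg₀ d₁ , transported-ᵀ r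
    ⊢*-ren (arg+ d ds sd) with ⊢-ren d | ⊢*-ren ds
    ... | _ , d₁ , r | _ , ds₁ , s = _ , arg+ d₁ ds₁ (transported-sd r s sd) , transported-⊓ r s

  typeable-ren : ∀ {N} → Typeable N → Typeable (ren f N)
  typeable-ren (_ , τ , d) = let (Γ' , d' , _) = ⊢-ren d in Γ' , τ , d'

record ErasuresInv (Γ : Basis) (vs : List Var) (M : Term) (σ : Strict) : Set where
  constructor erasuresInv
  field
    {Γ'} : Basis
    body : Γ' ⊢ M ∶ σ
    erased : ∀ z → z ∈ vs → Γ z ≈ᵐ just [] × Γ' z ≡ nothing
    kept : ∀ z → z ∉ vs → Γ z ≈ᵐ Γ' z

invErasures : ∀ vs {Γ M σ} → Γ ⊢ erasures vs M ∶ σ → ErasuresInv Γ vs M σ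
invErasures [] d = erasuresInv d (λ _ ()) (λ _ _ → ≈ᵐ-refl)
invErasures (v ∷ vs) {Γ} d with invEra d
... | eraInv {Γ₁} fr d' c with invErasures vs d'
...   | erasuresInv {Γ'} d'' er kp with v ∈? vs
...     | yes m = ⊥-elim (just≢nothing (≈ᵐ-nothing← (≈ᵐ-sym (proj₁ (er v m))) fr))
...     | no v∉vs = erasuresInv d'' er' kp'
  where
  er' : ∀ z → z ∈ v ∷ vs → Γ z ≈ᵐ just [] × Γ' z ≡ nothing
  er' z (here refl) = ≈ᵐ-cast refl (sym (ext-here Γ₁ z [])) (c z) , ≈ᵐ-nothing→ (kp z v∉vs) fr
  er' z (there m) =
    let z≢v = λ (e : z ≡ v) → v∉vs (subst (_∈ vs) e m) in
    ≈ᵐ-trans (≈ᵐ-cast refl (sym (ext-there Γ₁ [] z≢v)) (c z)) (proj₁ (er z m)) , proj₂ (er z m)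
  kp' : ∀ z → z ∉ v ∷ vs → Γ z ≈ᵐ Γ' z
  kp' z z∉ = ≈ᵐ-trans (≈ᵐ-cast refl (sym (ext-there Γ₁ [] (λ e → z∉ (here e)))) (c z))
                      (kp z (λ m → z∉ (there m)))

∉-map-inj : ∀ {f : Var → Var} → Inj f → ∀ {w} vs → w ∉ vs → f w ∉ map f vs
∉-map-inj {f} inj vs w∉ m = w∉ (∈-map-inj inj vs m)

∉-map-apart : ∀ {f : Var → Var} {w : Var} vs → (∀ v → f v ≢ w) → w ∉ map f vs
∉-map-apart {f} vs apart m = let (u , _ , e) = ∈-map⁻ f m in apart u (sym e)

module IteratedDup {f g : Var → Var} (injf : Inj f) (injg : Inj g) (f≢g : ∀ v w → f v ≢ g w) where

  record DupsInv (Γ : Basis) (vs : List Var) (T : Term) (σ : Strict) : Set where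
    constructor dupsInv
    field
      {Γ*} : Basis
      body : Γ* ⊢ T ∶ σ
      split : ∀ v → v ∈ vs → Σ Inter λ a → Σ Inter λ b →
              Γ* (f v) ≡ just a × Γ* (g v) ≡ just b × Γ v ≈ᵐ just (a ++ b) × Γ* v ≡ nothing
      kept : ∀ z → z ∉ vs → z ∉ map f vs → z ∉ map g vs → Γ z ≈ᵐ Γ* z
      copies-fresh : ∀ v → v ∈ vs → Γ (f v) ≡ nothing × Γ (g v) ≡ nothing

  module DupsStep {w vs Γ Γ' α β T σ}
         (avoid : ∀ {v u} → u ∈ w ∷ vs → f v ≢ u × g v ≢ u) (w∉vs : w ∉ vs)
         (f₁ : Γ' (f w) ≡ nothing) (f₂ : (Γ' , f w ∶ α) (g w) ≡ nothing) (f₃ : Γ' w ≡ nothing)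
         (c : Γ ≈ᶜ (Γ' , w ∶ (α ++ β)))
         (ih : DupsInv ((Γ' , f w ∶ α) , g w ∶ β) vs T σ) where

    open DupsInv ih renaming (split to sp; kept to kp; copies-fresh to cf)

    Γ₁ : Basis
    Γ₁ = (Γ' , f w ∶ α) , g w ∶ β

    Γ₁-f : Γ₁ (f w) ≡ just α
    Γ₁-f = trans (ext-there _ β (f≢g w w)) (ext-here Γ' (f w) α)

    Γ₁-g : Γ₁ (g w) ≡ just β
    Γ₁-g = ext-here _ (g w) β

    Γ₁-other : ∀ {z} → z ≢ f w → z ≢ g w → Γ₁ z ≡ Γ' z
    Γ₁-other n₁ n₂ = trans (ext-there _ β n₂) (ext-there Γ' α n₁)

    Γ-other : ∀ {z} → z ≢ w → Γ z ≈ᵐ Γ' z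
    Γ-other z≢w = ≈ᵐ-cast refl (sym (ext-there Γ' (α ++ β) z≢w)) (c _)

    f-kept : Γ₁ (f w) ≈ᵐ Γ* (f w)
    f-kept = kp (f w) (λ m → proj₁ (avoid {w} (there m)) refl) (∉-map-inj injf vs w∉vs)
                (∉-map-apart vs (λ u e → f≢g w u (sym e)))

    g-kept : Γ₁ (g w) ≈ᵐ Γ* (g w)
    g-kept = kp (g w) (λ m → proj₂ (avoid {w} (there m)) refl) (∉-map-apart vs (λ u e → f≢g u w e))
                (∉-map-inj injg vs w∉vs)

    split' : ∀ v → v ∈ w ∷ vs → Σ Inter λ a → Σ Inter λ b →
             Γ* (f v) ≡ just a × Γ* (g v) ≡ just b × Γ v ≈ᵐ just (a ++ b) × Γ* v ≡ nothing
    split' v (here refl) =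
      let (α' , eα , pα) = Pointwise.just-inv (≈ᵐ-cast (sym Γ₁-f) refl f-kept)
          (β' , eβ , pβ) = Pointwise.just-inv (≈ᵐ-cast (sym Γ₁-g) refl g-kept)
          v≢fv = λ (e : v ≡ f v) → proj₁ (avoid {v} (here refl)) (sym e)
          v≢gv = λ (e : v ≡ g v) → proj₂ (avoid {v} (here refl)) (sym e)
      in α' , β' , eα , eβ ,
         ≈ᵐ-trans (≈ᵐ-cast refl (sym (ext-here Γ' v (α ++ β))) (c v)) (just (++-cong pα pβ)) ,
         ≈ᵐ-nothing→ (kp v w∉vs (∉-map-apart vs (λ u e → proj₁ (avoid {u} (here refl)) e))
                                (∉-map-apart vs (λ u e → proj₂ (avoid {u} (here refl)) e)))
                     (trans (Γ₁-other v≢fv v≢gv) f₃)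
    split' v (there m) =
      let (a , b , e₁ , e₂ , p , e₃) = sp v m
          v≢w = λ (e : v ≡ w) → w∉vs (subst (_∈ vs) e m)
          v≢fw = λ (e : v ≡ f w) → proj₁ (avoid {w} (there m)) (sym e)
          v≢gw = λ (e : v ≡ g w) → proj₂ (avoid {w} (there m)) (sym e)
      in a , b , e₁ , e₂ , ≈ᵐ-trans (Γ-other v≢w) (≈ᵐ-cast (sym (Γ₁-other v≢fw v≢gw)) refl p) , e₃

    kept' : ∀ z → z ∉ w ∷ vs → z ∉ map f (w ∷ vs) → z ∉ map g (w ∷ vs) → Γ z ≈ᵐ Γ* z
    kept' z n₀ n₁ n₂ =
      ≈ᵐ-trans (Γ-other (λ e → n₀ (here e)))
        (≈ᵐ-cast (sym (Γ₁-other (λ e → n₁ (here e)) (λ e → n₂ (here e)))) refl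
          (kp z (λ m → n₀ (there m)) (λ m → n₁ (there m)) (λ m → n₂ (there m))))

    fresh' : ∀ v → v ∈ w ∷ vs → Γ (f v) ≡ nothing × Γ (g v) ≡ nothing
    fresh' v (here refl) =
      ≈ᵐ-nothing← (Γ-other (λ e → proj₁ (avoid {v} (here refl)) e)) f₁ ,
      ≈ᵐ-nothing← (Γ-other (λ e → proj₂ (avoid {v} (here refl)) e)) (proj₂ (ext-nothing⁻ Γ' f₂))
    fresh' v (there m) =
      let v≢w = λ (e : v ≡ w) → w∉vs (subst (_∈ vs) e m)
          (e₁ , e₂) = cf v m
      in ≈ᵐ-nothing← (Γ-other (λ e → proj₁ (avoid {v} (here refl)) e))
           (trans (sym (Γ₁-other (λ e → v≢w (injf e)) (λ e → f≢g v w e))) e₁) ,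
         ≈ᵐ-nothing← (Γ-other (λ e → proj₂ (avoid {v} (here refl)) e))
           (trans (sym (Γ₁-other (λ e → f≢g w v (sym e)) (λ e → v≢w (injg e)))) e₂)

    result : DupsInv Γ (w ∷ vs) T σ
    result = dupsInv body split' kept' fresh'

  invDups : ∀ vs {Γ T σ} → (∀ {v w} → w ∈ vs → f v ≢ w × g v ≢ w) →
            Γ ⊢ dups vs (map f vs) (map g vs) T ∶ σ → DupsInv Γ vs T σ
  invDups [] _ d = dupsInv d (λ _ ()) (λ _ _ _ _ → ≈ᵐ-refl) (λ _ ())
  invDups (w ∷ vs) avoid d with invDup d
  ... | dupInv {Γ'} {α} {β} f₁ f₂ f₃ d' c with invDups vs (λ m → avoid (there m)) d' | w ∈? vs
  ...   | ih | no w∉vs = DupsStep.result avoid w∉vs f₁ f₂ f₃ c ih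
  ...   | ih | yes m = ⊥-elim (just≢nothing (trans (sym Γ₁-f) (proj₁ (DupsInv.copies-fresh ih w m))))
    where
    -- w cannot occur twice: its copy f w is already bound
    Γ₁-f : ((Γ' , f w ∶ α) , g w ∶ β) (f w) ≡ just α
    Γ₁-f = trans (ext-there _ β (f≢g w w)) (ext-here Γ' (f w) α)

record Expansion (Γ : Basis) (x : Var) (M N : Term) (σ : Strict) : Set where
  constructor expansion
  field
    {Γ₀} : Basis
    {α} : Inter
    {Δ} : Basis
    fresh : Γ₀ x ≡ nothing
    body : (Γ₀ , x ∶ α) ⊢ M ∶ σ
    arg : Δ ⊢* N ∶ α
    disjoint : DisjointDom Γ₀ Δ
    basis≈ : Γ ≈ᶜ (Γ₀ ⊎ᶜ Δ)

record Expansion* (Γ : Basis) (x : Var) (M N : Term) (τs : Inter) : Set where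
  constructor expansion*
  field
    {Γ₀} : Basis
    {α} : Inter
    {Δ} : Basis
    {B} : Basis
    body : B ⊢* M ∶ τs
    body≈ : B ≈ᶜ (Γ₀ , x ∶ α)
    fresh : Γ₀ x ≡ nothing
    arg : Δ ⊢* N ∶ α
    disjoint : DisjointDom Γ₀ Δ
    basis≈ : Γ ≈ᶜ (Γ₀ ⊎ᶜ Δ)

-- x⟨N/x⟩ = N : the argument is used once
expand-var : ∀ {Γ x N σ} → Γ ⊢ N ∶ σ → Expansion Γ x (` x) N σ
expand-var {Γ} {σ = σ} t =
  expansion {Γ₀ = ∅} {σ ∷ []} refl Ax (arg+ t (arg₀ t) (sd-ᵀ Γ)) (λ _ → inj₁ refl) (⊓-ᵀ-self Γ)

-- (λy.M)⟨N/x⟩ = λy.M⟨N/x⟩ : the binder y is moved from Γ₀ into the body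
expand-abs : ∀ {Γ Γ' x y α' σ σ' M N} → y ≢ x → y ∉ fv N → Γ' y ≡ nothing →
             (α' ⇒ σ') ≈ˢ σ → Γ ≈ᶜ Γ' → Expansion (Γ' , y ∶ α') x M N σ' →
             Expansion Γ x (ƛ y ⇒ M) N σ
expand-abs {Γ} {Γ'} {x} {y} {α'} {σ} {σ'} {M} y≢x y∉N fy t≈ c (expansion {Γ₀} {β} {Δ} fr dM dN dis ctx) =
  expansion (trans (del-there Γ₀ (≢-sym y≢x)) fr) (Conv abs ≈ᶜ-refl t≈) dN (dis-del dis) basis≈
  where
  Δy : Δ y ≡ nothing
  Δy = dom*-∉ dN y∉N
  Γ₀y : Γ₀ y ≈ᵐ just α'
  Γ₀y = ≈ᵐ-sym (≈ᵐ-cast (sym (ext-here Γ' y α')) (sym (⊎-nothingʳ Γ₀ Δ Δy)) (ctx y))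
  abs : (del y Γ₀ , x ∶ β) ⊢ ƛ y ⇒ M ∶ (α' ⇒ σ')
  abs = →I (ext-nothing⁺ (del y Γ₀) {x} {y} {β} y≢x (del-here y Γ₀))
           (Conv dM (≈ᶜ-trans (ext-cong (split-at {Γ₀} {y} {α'} Γ₀y) (≈ᵢ-refl β)) (ext-swap {del y Γ₀} {y} {x} y≢x))
                 (≈ˢ-refl _))
  basis≈ : Γ ≈ᶜ (del y Γ₀ ⊎ᶜ Δ)
  basis≈ = ≈ᶜ-trans c (≈ᶜ-trans (del-fresh {Γ'} {y} fy)
             (≈ᶜ-trans (≈ᶜ-sym (del-ext-same {Γ'} {y} {α'}))
               (≈ᶜ-trans (del-cong ctx) (del-⊎ {Γ₀} {Δ} Δy))))

-- (M P)⟨N/x⟩ = M⟨N/x⟩ P : the typing of P joins the basis of M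
expand-appL : ∀ {Γ Γ₁ Γ₂ x τs σ M P N} → x ∉ fv P → Γ₂ ⊢* P ∶ τs → DisjointDom Γ₁ Γ₂ →
              Γ ≈ᶜ (Γ₁ ⊎ᶜ Γ₂) → Expansion Γ₁ x M N (τs ⇒ σ) → Expansion Γ x (M · P) N σ
expand-appL {Γ₂ = Γ₂} {x} {σ = σ} {M} {P} x∉P d₂ dis c (expansion {Γ₀} {α} {Δ} fr dM dN dis' ctx) =
  expansion (trans (⊎-nothingˡ Γ₀ _ fr) Γ₂x) app dN (dis-⊎ˡ dis' Γ₂Δ)
            (≈ᶜ-trans c (≈ᶜ-trans (⊎-congˡ ctx) (⊎-swap₂₃ {Γ₀} {Δ} (dis-sym Γ₂Δ))))
  where
  Γ₂x : Γ₂ x ≡ nothing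
  Γ₂x = dom*-∉ d₂ x∉P
  parts : DisjointDom Γ₂ Γ₀ × DisjointDom Γ₂ Δ
  parts = dis-⊎ʳ⁻ (dis-sym dis) ctx
  Γ₂Δ : DisjointDom Γ₂ Δ
  Γ₂Δ = proj₂ parts
  app : ((Γ₀ ⊎ᶜ Γ₂) , x ∶ α) ⊢ M · P ∶ σ
  app = Conv (→E dM d₂ (dis-extˡ⁺ (dis-sym (proj₁ parts)) Γ₂x)) (ext-⊎ˡ {Γ₀} {_} {x} {α}) (≈ˢ-refl _)

-- (M P)⟨N/x⟩ = M P⟨N/x⟩ : the typing of M joins the basis of P
expand-appR : ∀ {Γ Γ₁ Γ₂ x τs σ M P N} → x ∉ fv M → Γ₁ ⊢ M ∶ (τs ⇒ σ) → DisjointDom Γ₁ Γ₂ →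
              Γ ≈ᶜ (Γ₁ ⊎ᶜ Γ₂) → Expansion* Γ₂ x P N τs → Expansion Γ x (M · P) N σ
expand-appR {Γ₁ = Γ₁} {x = x} {σ = σ} {M} {P} x∉M d₁ dis c (expansion* {Γ₀} {A} {Δ} dP cP fr dN dis' ctx) =
  expansion (trans (⊎-nothingˡ Γ₁ Γ₀ Γ₁x) fr) app dN (dis-⊎ˡ (proj₂ parts) dis')
            (≈ᶜ-trans c (≈ᶜ-trans (⊎-congʳ {Γ₁} ctx) (≈ᶜ-sym (⊎-assoc {Γ₁} {Γ₀} {Δ}))))
  where
  Γ₁x : Γ₁ x ≡ nothing
  Γ₁x = dom-∉ d₁ x∉M
  parts : DisjointDom Γ₁ Γ₀ × DisjointDom Γ₁ Δ
  parts = dis-⊎ʳ⁻ dis ctx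
  app : ((Γ₁ ⊎ᶜ Γ₀) , x ∶ A) ⊢ M · P ∶ σ
  app = Conv (→E d₁ dP (dis-≈ʳ (≈ᶜ-sym cP) (dis-extʳ⁺ (proj₁ parts) Γ₁x)))
             (≈ᶜ-trans (⊎-congʳ {Γ₁} cP) (ext-⊎ʳ {Γ₁} {Γ₀} {x} {A} Γ₁x)) (≈ˢ-refl _)

expand-era : ∀ {Γ Γ' x y σ M N} → y ≢ x → Γ' y ≡ nothing → Γ ≈ᶜ (Γ' , y ∶ []) →
             Expansion Γ' x M N σ → Expansion Γ x (y ⊙ M) N σ
expand-era {x = x} {y} {σ} {M} y≢x fy c (expansion {Γ₀} {α} {Δ} fr dM dN dis ctx) =
  expansion (ext-nothing⁺ Γ₀ {y} {x} {[]} (≢-sym y≢x) fr)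
            (Conv thin (ext-swap (≢-sym y≢x)) (≈ˢ-refl _)) dN (dis-extˡ⁺ dis (proj₂ fy'))
            (≈ᶜ-trans c (≈ᶜ-trans (ext-cong ctx (≈ᵢ-refl [])) (≈ᶜ-sym (ext-⊎ˡ {Γ₀} {Δ} {y} {[]}))))
  where
  fy' : Γ₀ y ≡ nothing × Δ y ≡ nothing
  fy' = ⊎-nothing⁻ Γ₀ Δ (≈ᵐ-nothing→ (ctx y) fy)
  thin : ((Γ₀ , x ∶ α) , y ∶ []) ⊢ y ⊙ M ∶ σ
  thin = Thin (ext-nothing⁺ Γ₀ {x} {y} {α} y≢x (proj₁ fy')) dM

-- (x ⊙ M)⟨N/x⟩ = Fv(N) ⊙ M : the argument is discarded, x gets type ⊤
expand-era≡ : ∀ {Γ x σ M N} → x ∉ fv M → Typeable N → Γ ⊢ erasures (fv N) M ∶ σ →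
              Expansion Γ x (x ⊙ M) N σ
expand-era≡ {Γ} {x} {N = N} x∉M (Δ₀ , _ , dN₀) t with invErasures (fv N) t
... | erasuresInv {Γ'} t' er kp =
  expansion Γ'x (Thin Γ'x t') (arg₀ dN₀) dis basis≈
  where
  Γ'x : Γ' x ≡ nothing
  Γ'x = dom-∉ t' x∉M
  dis : DisjointDom Γ' (Δ₀ ᵀ)
  dis z with z ∈? fv N
  ... | yes m = inj₁ (proj₂ (er z m))
  ... | no z∉ = inj₂ (ᵀ-nothing Δ₀ (dom-∉ dN₀ z∉))
  basis≈ : Γ ≈ᶜ (Γ' ⊎ᶜ (Δ₀ ᵀ))
  basis≈ z with z ∈? fv N
  ... | yes m = ≈ᵐ-cast refl (trans (⊎-nothingˡ Γ' (Δ₀ ᵀ) (proj₂ (er z m))) (ᵀ-just Δ₀ (proj₂ (dom-∈ dN₀ m))))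
                  (proj₁ (er z m))
  ... | no z∉ = ≈ᵐ-cast refl (⊎-nothingʳ Γ' (Δ₀ ᵀ) (ᵀ-nothing Δ₀ (dom-∉ dN₀ z∉))) (kp z z∉)

-- (y <^{y₁}_{y₂} M)⟨N/x⟩ = y <^{y₁}_{y₂} M⟨N/x⟩ : the copies y₁, y₂ are
-- moved from Γ₀ into the body
expand-dup : ∀ {Γ Γ' x y y₁ y₂ a b σ M N} → y ≢ x → y₁ ≢ x → y₂ ≢ x → y₁ ∉ fv N → y₂ ∉ fv N →
             Γ' y₁ ≡ nothing → (Γ' , y₁ ∶ a) y₂ ≡ nothing → Γ' y ≡ nothing → Γ ≈ᶜ (Γ' , y ∶ (a ++ b)) →
             Expansion ((Γ' , y₁ ∶ a) , y₂ ∶ b) x M N σ → Expansion Γ x (dup y y₁ y₂ M) N σ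
expand-dup {Γ' = Γ'} {x} {y} {y₁} {y₂} {a} {b} {σ} {M} y≢x y₁≢x y₂≢x y₁∉N y₂∉N f₁ f₂ f c
           (expansion {Γ₀} {β} {Δ} fr dM dN dis ctx) =
  expansion (ext-nothing⁺ Γc {y} {x} {a ++ b} (≢-sym y≢x) Γcx)
            (Conv cont (ext-swap {Γc} {x} {y} (≢-sym y≢x)) (≈ˢ-refl _)) dN
            (dis-extˡ⁺ (dis-del (dis-del dis)) (proj₂ y-fresh))
            (≈ᶜ-trans c (≈ᶜ-trans (ext-cong Γ'≈ (≈ᵢ-refl (a ++ b))) (≈ᶜ-sym (ext-⊎ˡ {Γc} {Δ} {y} {a ++ b}))))
  where
  Δy₁ : Δ y₁ ≡ nothing
  Δy₁ = dom*-∉ dN y₁∉N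
  Δy₂ : Δ y₂ ≡ nothing
  Δy₂ = dom*-∉ dN y₂∉N
  y₂≢y₁ : y₂ ≢ y₁
  y₂≢y₁ = proj₁ (ext-nothing⁻ Γ' {y₁} {y₂} {a} f₂)
  Γ'y₂ : Γ' y₂ ≡ nothing
  Γ'y₂ = proj₂ (ext-nothing⁻ Γ' {y₁} {y₂} {a} f₂)
  Γ₀y₂ : Γ₀ y₂ ≈ᵐ just b
  Γ₀y₂ = ≈ᵐ-sym (≈ᵐ-cast (sym (ext-here _ y₂ b)) (sym (⊎-nothingʳ Γ₀ Δ Δy₂)) (ctx y₂))
  Γ₀y₁ : Γ₀ y₁ ≈ᵐ just a
  Γ₀y₁ = ≈ᵐ-sym (≈ᵐ-cast (sym (trans (ext-there _ b (≢-sym y₂≢y₁)) (ext-here Γ' y₁ a)))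
                         (sym (⊎-nothingʳ Γ₀ Δ Δy₁)) (ctx y₁))
  Γc : Basis
  Γc = del y₁ (del y₂ Γ₀)
  Γ₀≈ : Γ₀ ≈ᶜ ((Γc , y₁ ∶ a) , y₂ ∶ b)
  Γ₀≈ = ≈ᶜ-trans (split-at {Γ₀} {y₂} {b} Γ₀y₂)
          (ext-cong (split-at {del y₂ Γ₀} {y₁} {a} (≈ᵐ-cast (del-there Γ₀ (≢-sym y₂≢y₁)) refl Γ₀y₁)) (≈ᵢ-refl b))
  dM' : ((Γc , x ∶ β) , y₁ ∶ a) , y₂ ∶ b ⊢ M ∶ σ
  dM' = Conv dM (≈ᶜ-trans (ext-cong Γ₀≈ (≈ᵢ-refl β))
                 (≈ᶜ-trans (ext-swap {Γc , y₁ ∶ a} {y₂} {x} {b} {β} y₂≢x)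
                   (ext-cong (ext-swap {Γc} {y₁} {x} {a} {β} y₁≢x) (≈ᵢ-refl b)))) (≈ˢ-refl _)
  y-fresh : Γc y ≡ nothing × Δ y ≡ nothing
  y-fresh with ≡-or-≢ y y₁ | ≡-or-≢ y y₂
  ... | inj₁ refl | _ = del-here y _ , Δy₁
  ... | inj₂ _ | inj₁ refl = trans (del-there _ y₂≢y₁) (del-here y Γ₀) , Δy₂
  ... | inj₂ y≢y₁ | inj₂ y≢y₂ =
    let e = ⊎-nothing⁻ Γ₀ Δ (≈ᵐ-nothing→ (ctx y) (trans (ext-there _ b y≢y₂) (trans (ext-there Γ' a y≢y₁) f)))
    in trans (del-there _ y≢y₁) (trans (del-there Γ₀ y≢y₂) (proj₁ e)) , proj₂ e
  cont : ((Γc , x ∶ β) , y ∶ (a ++ b)) ⊢ dup y y₁ y₂ M ∶ σ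
  cont = Cont {Γ = Γc , x ∶ β} (ext-nothing⁺ Γc {x} {y₁} {β} y₁≢x (del-here y₁ _))
           (ext-nothing⁺ _ {y₁} {y₂} {a} y₂≢y₁
             (ext-nothing⁺ Γc {x} {y₂} {β} y₂≢x (trans (del-there _ y₂≢y₁) (del-here y₂ Γ₀))))
           (ext-nothing⁺ Γc {x} {y} {β} y≢x (proj₁ y-fresh)) dM'
  Γcx : Γc x ≡ nothing
  Γcx = trans (del-there _ (≢-sym y₁≢x)) (trans (del-there Γ₀ (≢-sym y₂≢x)) fr)
  Γ'≈ : Γ' ≈ᶜ (Γc ⊎ᶜ Δ)
  Γ'≈ z with ≡-or-≢ z y₁ | ≡-or-≢ z y₂
  ... | inj₁ refl | _ = ≈ᵐ-by f₁ (trans (⊎-nothingˡ Γc Δ (del-here z _)) Δy₁)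
  ... | inj₂ _ | inj₁ refl = ≈ᵐ-by Γ'y₂ (trans (⊎-nothingˡ Γc Δ (trans (del-there _ y₂≢y₁) (del-here z Γ₀))) Δy₂)
  ... | inj₂ z≢y₁ | inj₂ z≢y₂ =
    ≈ᵐ-cast (sym (trans (ext-there _ b z≢y₂) (ext-there Γ' a z≢y₁))) refl
      (≈ᵐ-trans (ctx z) (⊎-cong-at {Γc} {Γ₀} {Δ} {Δ} {z} {z}
                          (≡⇒≈ᵐ (sym (trans (del-there _ z≢y₁) (del-there Γ₀ z≢y₂)))) ≈ᵐ-refl))

-- The case  (x <^{x₁}_{x₂} M)[N/x] = Fv[N] <^{Fv[N₁]}_{Fv[N₂]} M⟨N₁/x₁⟩⟨N₂/x₂⟩
-- of the expansion lemma.  The duplications are inverted, the two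
-- substitutions are expanded (the hypotheses IH₂ and IH₁), the typings
-- of the fresh copies N₁ and N₂ are pulled back to N and concatenated,
-- and x receives the intersection α ∩ β of the types of x₁ and x₂.

module DupSubst {x x₁ x₂ M N R₁ R₂ Γ σ} {f g : Var → Var}
       (fp : FreshPair f g (vars (dup x x₁ x₂ M) ++ vars N))
       (x∉ : x ∉ remove x₁ (remove x₂ (fv M)))
       (t : Γ ⊢ dups (fv N) (map f (fv N)) (map g (fv N)) R₂ ∶ σ)
       (IH₂ : ∀ {Γ σ} → Γ ⊢ R₂ ∶ σ → Expansion Γ x₂ R₁ (ren g N) σ)
       (IH₁ : ∀ {Γ σ} → Γ ⊢ R₁ ∶ σ → Expansion Γ x₁ M (ren f N) σ) where

  open Copies x x₁ x₂ M N fp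
  open IteratedDup injf injg f≢g

  inv : DupsInv Γ (fv N) R₂ σ
  inv = invDups (fv N) (λ m → N-avoids-f m , N-avoids-g m) t
  open DupsInv inv

  -- Γ* ≈ Γ₂ ⊎ Δ₂  with  (Γ₂ , x₂ ∶ β) ⊢ R₁ ∶ σ  and  Δ₂ ⊢* N₂ ∶ β
  open Expansion (IH₂ body)
    renaming (Γ₀ to Γ₂; α to β; Δ to Δ₂; fresh to fresh₂; body to body₂; arg to arg₂; disjoint to dis₂; basis≈ to c₂)

  -- Γ₂ , x₂ ∶ β ≈ Γ₁ ⊎ Δ₁  with  (Γ₁ , x₁ ∶ α) ⊢ M ∶ σ  and  Δ₁ ⊢* N₁ ∶ α
  open Expansion (IH₁ body₂)
    renaming (Γ₀ to Γ₁; Δ to Δ₁; fresh to fresh₁; body to body₁; arg to arg₁; disjoint to dis₁; basis≈ to c₁)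

  pulled₁ : Σ Basis λ D₁ → D₁ ⊢* N ∶ α × D₁ ≈ᶜ (Δ₁ ∘ᶠ f)
  pulled₁ = Renaming.⊢*-unren injf N arg₁

  pulled₂ : Σ Basis λ D₂ → D₂ ⊢* N ∶ β × D₂ ≈ᶜ (Δ₂ ∘ᶠ g)
  pulled₂ = Renaming.⊢*-unren injg N arg₂

  combined : Σ Basis λ D → D ⊢* N ∶ (α ++ β) × D ≈ᶜ (proj₁ pulled₁ ⊓ proj₁ pulled₂)
  combined = ⊢*-++ (proj₁ (proj₂ pulled₁)) (proj₁ (proj₂ pulled₂))

  D : Basis
  D = proj₁ combined

  arg : D ⊢* N ∶ (α ++ β)
  arg = proj₁ (proj₂ combined)

  D≈copies : ∀ z → D z ≈ᵐ ((Δ₁ ∘ᶠ f) ⊓ (Δ₂ ∘ᶠ g)) z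
  D≈copies z = ≈ᵐ-trans (proj₂ (proj₂ combined) z)
                 (⊓-cong-at {Δ₁ ∘ᶠ f} {proj₁ pulled₁} {Δ₂ ∘ᶠ g} {proj₁ pulled₂} {z} {z}
                   (proj₂ (proj₂ pulled₁) z) (proj₂ (proj₂ pulled₂) z))

  -- Γ₁ ⊎ Δ₁ is Γ₂ , x₂ ∶ β, so away from x₂ and N₁ the bases Γ₁ and Γ₂ agree
  Γ₂≈Γ₁ : ∀ {z} → z ≢ x₂ → Δ₁ z ≡ nothing → Γ₂ z ≈ᵐ Γ₁ z
  Γ₂≈Γ₁ {z} z≢x₂ e = ≈ᵐ-cast (sym (ext-there Γ₂ β z≢x₂)) (sym (⊎-nothingʳ Γ₁ Δ₁ e)) (c₁ z)

  Γ₁-nothing : ∀ {z} → z ≢ x₂ → Γ₂ z ≡ nothing → Γ₁ z ≡ nothing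
  Γ₁-nothing {z} z≢x₂ e = proj₁ (⊎-nothing⁻ Γ₁ Δ₁ (≈ᵐ-nothing→ (c₁ z) (ext-nothing⁺ Γ₂ z≢x₂ e)))

  Γ₁x₂ : Γ₁ x₂ ≈ᵐ just β
  Γ₁x₂ = ≈ᵐ-sym (≈ᵐ-cast (sym (ext-here Γ₂ x₂ β)) (sym (⊎-nothingʳ Γ₁ Δ₁ (dom*-∉ arg₁ x₂∉N₁))) (c₁ x₂))

  x₁≢x₂ : x₁ ≢ x₂
  x₁≢x₂ refl = just≢nothing (≈ᵐ-nothing← (≈ᵐ-sym Γ₁x₂) fresh₁)

  Γc : Basis
  Γc = del x₂ Γ₁

  Γc-x : Γc x ≡ nothing
  Γc-x with ≡-or-≢ x x₂ | ≡-or-≢ x x₁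
  ... | inj₁ refl | _ = del-here x Γ₁
  ... | inj₂ x≢x₂ | inj₁ refl = trans (del-there Γ₁ x≢x₂) fresh₁
  ... | inj₂ x≢x₂ | inj₂ x≢x₁ =
    trans (del-there Γ₁ x≢x₂)
      (trans (sym (ext-there Γ₁ α x≢x₁)) (dom-∉ body₁ (λ m → x∉ (∈-remove₂⁺ (fv M) m x≢x₂ x≢x₁))))

  cont : (Γc , x ∶ (α ++ β)) ⊢ dup x x₁ x₂ M ∶ σ
  cont = Cont (trans (del-there Γ₁ x₁≢x₂) fresh₁) (ext-nothing⁺ Γc (≢-sym x₁≢x₂) (del-here x₂ Γ₁)) Γc-x
           (Conv body₁ (≈ᶜ-trans (ext-cong (split-at {Γ₁} {x₂} {β} Γ₁x₂) (≈ᵢ-refl α))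
                                 (ext-swap {Γc} {x₂} {x₁} {β} {α} (≢-sym x₁≢x₂)))
                 (≈ˢ-refl _))

  Γc-vs : ∀ {v} → v ∈ fv N → Γc v ≡ nothing
  Γc-vs {v} m with ≡-or-≢ v x₂
  ... | inj₁ refl = del-here v Γ₁
  ... | inj₂ v≢x₂ =
    let (_ , _ , _ , _ , _ , Γ*v) = split v m in
    trans (del-there Γ₁ v≢x₂) (Γ₁-nothing v≢x₂ (proj₁ (⊎-nothing⁻ Γ₂ Δ₂ (≈ᵐ-nothing→ (c₂ v) Γ*v))))

  Γ≈D-on-N : ∀ {z} → z ∈ fv N → Γ z ≈ᵐ D z
  Γ≈D-on-N {z} m =
    let (a , b , ea , eb , Γz , _) = split z m
        fz∈N₁ = ∈-fv-ren⁺ injf N m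
        gz∈N₂ = ∈-fv-ren⁺ injg N m
        at-f : Γ* (f z) ≈ᵐ Δ₁ (f z)
        at-f = ≈ᵐ-trans (≈ᵐ-cast refl (sym (⊎-nothingʳ Γ₂ Δ₂ (dom*-∉ arg₂ (apart fz∈N₁)))) (c₂ (f z)))
                        (≈ᵐ-cast refl (sym (⊎-nothingˡ Γ₁ Δ₁ (dis-fv* dis₁ arg₁ fz∈N₁)))
                          (≈ᵐ-cast (sym (ext-there Γ₂ β (f≢x₂ z))) refl (c₁ (f z))))
        at-g : Γ* (g z) ≈ᵐ Δ₂ (g z)
        at-g = ≈ᵐ-cast refl (sym (⊎-nothingˡ Γ₂ Δ₂ (dis-fv* dis₂ arg₂ gz∈N₂))) (c₂ (g z))
        copies : just (a ++ b) ≈ᵐ D z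
        copies = ≈ᵐ-sym (≈ᵐ-trans (D≈copies z)
                   (≈ᵐ-cast refl (sym (⊓-just (Γ* ∘ᶠ f) (Γ* ∘ᶠ g) {z} ea eb))
                     (⊓-cong-at {Γ* ∘ᶠ f} {Δ₁ ∘ᶠ f} {Γ* ∘ᶠ g} {Δ₂ ∘ᶠ g} {z} {z} (≈ᵐ-sym at-f) (≈ᵐ-sym at-g))))
    in ≈ᵐ-trans Γz copies

  Γ≈Γc-off-N : ∀ {z} → z ∉ fv N → Γ z ≈ᵐ Γc z
  Γ≈Γc-off-N {z} z∉N with z ∈? map f (fv N) | z ∈? map g (fv N)
  ... | yes mf | _ with ∈-map⁻ f mf
  ...   | w , mw , refl =
    ≈ᵐ-by (proj₁ (copies-fresh w mw)) (trans (del-there Γ₁ (f≢x₂ w)) (dis-fv* dis₁ arg₁ (∈-fv-ren⁺ injf N mw)))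
  Γ≈Γc-off-N {z} z∉N | no _ | yes mg with ∈-map⁻ g mg
  ...   | w , mw , refl =
    ≈ᵐ-by (proj₂ (copies-fresh w mw))
          (trans (del-there Γ₁ (g≢x₂ w)) (Γ₁-nothing (g≢x₂ w) (dis-fv* dis₂ arg₂ (∈-fv-ren⁺ injg N mw))))
  Γ≈Γc-off-N {z} z∉N | no z∉f | no z∉g =
    ≈ᵐ-trans (kept z z∉N z∉f z∉g)
      (≈ᵐ-trans (≈ᵐ-cast refl (sym (⊎-nothingʳ Γ₂ Δ₂ (dom*-∉ arg₂ (∉-fv-ren injg N z∉g)))) (c₂ z)) Γ₂≈Γc)
    where
    Γ₂≈Γc : Γ₂ z ≈ᵐ Γc z
    Γ₂≈Γc with ≡-or-≢ z x₂
    ... | inj₁ refl = ≈ᵐ-by fresh₂ (del-here z Γ₁)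
    ... | inj₂ z≢x₂ = ≈ᵐ-cast refl (del-there Γ₁ z≢x₂) (Γ₂≈Γ₁ z≢x₂ (dom*-∉ arg₁ (∉-fv-ren injf N z∉f)))

  disjoint : DisjointDom Γc D
  disjoint z with z ∈? fv N
  ... | yes m = inj₁ (Γc-vs m)
  ... | no z∉N = inj₂ (dom*-∉ arg z∉N)

  basis≈ : Γ ≈ᶜ (Γc ⊎ᶜ D)
  basis≈ z with z ∈? fv N
  ... | yes m = ≈ᵐ-cast refl (⊎-nothingˡ Γc D (Γc-vs m)) (Γ≈D-on-N m)
  ... | no z∉N = ≈ᵐ-cast refl (⊎-nothingʳ Γc D (dom*-∉ arg z∉N)) (Γ≈Γc-off-N z∉N)

  result : Expansion Γ x (dup x x₁ x₂ M) N σ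
  result = expansion Γc-x cont arg disjoint basis≈

-- Expansion for argument derivations: the components are expanded one by
-- one and the resulting typings of M and of N are intersected.

expand*-arg₀ : ∀ {Γ x M N σ} → Typeable N → Expansion Γ x M N σ → Expansion* (Γ ᵀ) x M N []
expand*-arg₀ {Γ} {x} (ΔN , _ , dN) (expansion {Γ₀} {α} {Δ} fr dM ds dis c) =
  expansion* (arg₀ dM) (ᵀ-ext {Γ₀} {x} {α}) (ᵀ-nothing Γ₀ fr) (arg₀ dN) dis' basis≈
  where
  dis' : DisjointDom (Γ₀ ᵀ) (ΔN ᵀ)
  dis' z with maybe-case (Γ₀ z)
  ... | inj₁ e = inj₁ (ᵀ-nothing Γ₀ e)
  ... | inj₂ (a , e) with dis z
  ...   | inj₁ e' = ⊥-elim (just≢nothing (trans (sym e) e'))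
  ...   | inj₂ e' = inj₂ (ᵀ-nothing ΔN (dom-∉ dN (dom*-nothing⇒∉ ds e')))
  basis≈ : (Γ ᵀ) ≈ᶜ ((Γ₀ ᵀ) ⊎ᶜ (ΔN ᵀ))
  basis≈ = ≈ᶜ-trans (ᵀ-cong c) (≈ᶜ-trans (ᵀ-⊎ {Γ₀} {Δ}) (⊎-congʳ {Γ₀ ᵀ} (ᵀ-sd (sd-sym (sd-⊢ dN ds)))))

expand*-arg+ : ∀ {Γ Θ x M N σ τs} → SameDom Γ Θ → Expansion Γ x M N σ → Expansion* Θ x M N τs →
               Expansion* (Γ ⊓ Θ) x M N (σ ∷ τs)
expand*-arg+ {Γ} {Θ} {x} {N = N} sd (expansion {Γᵢ} {αᵢ} {Δᵢ} frᵢ dMᵢ dsᵢ disᵢ cᵢ)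
                               (expansion* {Γ₀} {A} {Δ} dP cP fr ds dis c) =
  expansion* (arg+ dMᵢ dP (sd-≈ ≈ᶜ-refl (≈ᶜ-sym cP) (sd-ext⁺ {Γᵢ} {Γ₀} {x} {αᵢ} {A} sdΓ)))
             (≈ᶜ-trans (⊓-cong {Γᵢ , x ∶ αᵢ} ≈ᶜ-refl cP) (⊓-ext {Γᵢ} {Γ₀} {x} {αᵢ} {A}))
             (⊓-nothingˡ Γᵢ Γ₀ frᵢ) (proj₁ (proj₂ args)) dis' basis≈
  where
  args : Σ Basis λ D → D ⊢* N ∶ (αᵢ ++ A) × D ≈ᶜ (Δᵢ ⊓ Δ)
  args = ⊢*-++ dsᵢ ds
  sdΓ : SameDom Γᵢ Γ₀
  sdΓ z with z ∈? fv N
  ... | yes m = (λ _ → dis-fv* dis ds m) , (λ _ → dis-fv* disᵢ dsᵢ m)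
  ... | no z∉ =
    let pᵢ = ≈ᵐ-cast refl (sym (⊎-nothingʳ Γᵢ Δᵢ (dom*-∉ dsᵢ z∉))) (cᵢ z)
        p₀ = ≈ᵐ-cast refl (sym (⊎-nothingʳ Γ₀ Δ (dom*-∉ ds z∉))) (c z)
    in (λ e → ≈ᵐ-nothing→ p₀ (proj₁ (sd z) (≈ᵐ-nothing← pᵢ e))) ,
       (λ e → ≈ᵐ-nothing→ pᵢ (proj₂ (sd z) (≈ᵐ-nothing← p₀ e)))
  dis' : DisjointDom (Γᵢ ⊓ Γ₀) (proj₁ args)
  dis' z with disᵢ z
  ... | inj₁ e = inj₁ (⊓-nothingˡ Γᵢ Γ₀ e)
  ... | inj₂ e = inj₂ (≈ᵐ-nothing← (proj₂ (proj₂ args) z) (⊓-nothingˡ Δᵢ Δ e))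
  basis≈ : (Γ ⊓ Θ) ≈ᶜ ((Γᵢ ⊓ Γ₀) ⊎ᶜ proj₁ args)
  basis≈ = ≈ᶜ-trans (⊓-cong cᵢ c)
             (≈ᶜ-trans (⊓-⊎-distrib {Γᵢ} {Γ₀} {Δᵢ} {Δ} sdΓ) (⊎-congʳ {Γᵢ ⊓ Γ₀} (≈ᶜ-sym (proj₂ (proj₂ args)))))

mutual
  expand : ∀ {M N x R Γ σ} → Subst M N x R → Lin x M → AllLin N → Typeable N →
           Γ ⊢ R ∶ σ → Expansion Γ x M N σ
  expand s-var _ _ _ t = expand-var t
  expand (s-abs y≢x y∉N d) l al tN t with invAbs t
  ... | absInv fy t' t≈ c = expand-abs y≢x y∉N fy t≈ c (expand d (l (≢-sym y≢x)) al tN t')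
  expand (s-appL x∈M d) (x∉P , _ , lM , _) al tN t with invApp t
  ... | appInv d₁ d₂ dis c = expand-appL (x∉P x∈M) d₂ dis c (expand d lM al tN d₁)
  expand (s-appR x∈P d) (_ , x∉M , _ , lP) al tN t with invApp t
  ... | appInv d₁ d₂ dis c = expand-appR (x∉M x∈P) d₁ dis c (expand* d lP al tN d₂)
  expand (s-era y≢x d) (_ , lM) al tN t with invEra t
  ... | eraInv fy t' c = expand-era y≢x fy c (expand d lM al tN t')
  expand s-era≡ (x∉M , _) _ tN t = expand-era≡ (x∉M refl) tN t
  expand (s-dup y≢x y₁≢x y₂≢x y₁∉N y₂∉N d) (_ , lM) al tN t with invDup t
  ... | dupInv f₁ f₂ f t' c =
    expand-dup y≢x y₁≢x y₂≢x y₁∉N y₂∉N f₁ f₂ f c (expand d (lM (≢-sym y₁≢x) (≢-sym y₂≢x)) al tN t')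
  expand {N = N} {Γ = Γ} {σ} (s-dup≡ {x₁} {x₂} {M} {x = x} {R = R₂} f g fp d₁ d₂) (self , _) al tN t
    with self refl
  ... | x∉ , lx₁ , lx₂ =
    DupSubst.result fp x∉ (subst (λ T → Γ ⊢ T ∶ σ) (dups-ren injf injg N R₂) t)
      (expand d₂ (subst-Lin d₁ lx₁ lx₂ alN₁ x₂∉N₁) (AllLin-ren injg N al) (Renaming.typeable-ren injg tN))
      (expand d₁ lx₁ alN₁ (Renaming.typeable-ren injf tN))
    where
    open Copies x x₁ x₂ M N fp
    alN₁ : AllLin (ren f N)
    alN₁ = AllLin-ren injf N al

  expand* : ∀ {M N x R Γ τs} → Subst M N x R → Lin x M → AllLin N → Typeable N →
            Γ ⊢* R ∶ τs → Expansion* Γ x M N τs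
  expand* d l al tN (arg₀ t) = expand*-arg₀ tN (expand d l al tN t)
  expand* d l al tN (arg+ t ts sd) = expand*-arg+ sd (expand d l al tN t) (expand* d l al tN ts)

-- Part (ii), rule  x <^{x₁}_{x₂} (x₁ ⊙ M) → M⟨x/x₂⟩ : expanding the
-- substitution of the variable x types M with x₂ : α, and x receives
-- ⊤ ∩ α = α.
expand-γω≡ : ∀ {x x₁ x₂ M R Γ σ} → x₁ ∉ fv M → x₁ ≢ x₂ → Lin x₂ M →
             Subst M (` x) x₂ R → Γ ⊢ R ∶ σ → Γ ⊢ dup x x₁ x₂ (x₁ ⊙ M) ∶ σ
expand-γω≡ {x} {x₁} {x₂} {M} {Γ = Γ} {σ = σ} x₁∉M x₁≢x₂ lM sub t
  with expand sub lM (λ _ → tt) ((∅ , x ∶ (atom 0 ∷ [])) , atom 0 , Ax) t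
... | expansion {Γ₀} {α} {Δ} fr dM dN dis c = Conv cont (≈ᶜ-sym Γ≈) (≈ˢ-refl σ)
  where
  Δ≈ : Δ ≈ᶜ (∅ , x ∶ α)
  Δ≈ = var* dN
  Γ₀x : Γ₀ x ≡ nothing
  Γ₀x with dis x
  ... | inj₁ e = e
  ... | inj₂ e = ⊥-elim (just≢nothing (trans (sym (ext-here ∅ x α)) (≈ᵐ-nothing→ (Δ≈ x) e)))
  Γ₀x₁ : Γ₀ x₁ ≡ nothing
  Γ₀x₁ = proj₂ (ext-nothing⁻ Γ₀ {x₂} {x₁} {α} (dom-∉ dM x₁∉M))
  thin : ((Γ₀ , x₂ ∶ α) , x₁ ∶ []) ⊢ x₁ ⊙ M ∶ σ
  thin = Thin (ext-nothing⁺ Γ₀ {x₂} {x₁} {α} x₁≢x₂ Γ₀x₁) dM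
  cont : (Γ₀ , x ∶ ([] ++ α)) ⊢ dup x x₁ x₂ (x₁ ⊙ M) ∶ σ
  cont = Cont Γ₀x₁ (ext-nothing⁺ Γ₀ {x₁} {x₂} {[]} (≢-sym x₁≢x₂) fr) Γ₀x
           (Conv thin (ext-swap {Γ₀} {x₂} {x₁} {α} {[]} (≢-sym x₁≢x₂)) (≈ˢ-refl _))
  Γ≈ : Γ ≈ᶜ (Γ₀ , x ∶ α)
  Γ≈ = ≈ᶜ-trans c (≈ᶜ-trans (⊎-congʳ {Γ₀} Δ≈)
         (≈ᶜ-trans (ext-⊎ʳ {Γ₀} {∅} {x} {α} Γ₀x) (ext-cong ⊎-∅ (≈ᵢ-refl α))))

subject-expansion-β : ∀ {x M N R Γ σ} → WF ((ƛ x ⇒ M) · N) → Subst M N x R →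
                      Γ ⊢ R ∶ σ → Typeable N → Γ ⊢ (ƛ x ⇒ M) · N ∶ σ
subject-expansion-β {x} (wf-app (wf-abs wM _) wN _) sub t tN
  with expand sub (wf⇒AllLin wM x) (wf⇒AllLin wN) tN t
... | expansion fr dM dN dis c = Conv (→E (→I fr dM) dN dis) (≈ᶜ-sym c) (≈ˢ-refl _)

subject-expansion-nonβ : ∀ {M M' Γ σ} → WF M → NonBeta M M' → Γ ⊢ M' ∶ σ → Γ ⊢ M ∶ σ
subject-expansion-nonβ (wf-dup {M = ƛ y ⇒ M} _ x₁∈ x₂∈ _ _) (γ-abs y≢x) =
  expand-γ-abs y≢x (proj₂ (∈-remove⁻ (fv M) x₁∈)) (proj₂ (∈-remove⁻ (fv M) x₂∈))
subject-expansion-nonβ _ (γ-appL x₁∉N x₂∉N) = expand-γ-appL x₁∉N x₂∉N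
subject-expansion-nonβ _ (γ-appR x₁∉M x₂∉M) = expand-γ-appR x₁∉M x₂∉M
subject-expansion-nonβ _ (ω-abs x≢y) = expand-ω-abs x≢y
subject-expansion-nonβ _ ω-appL = expand-ω-appL
subject-expansion-nonβ _ ω-appR = expand-ω-appR
subject-expansion-nonβ _ (γω y≢x₁ y≢x₂) = expand-γω y≢x₁ y≢x₂
subject-expansion-nonβ (wf-dup (wf-era wM x₁∉M) _ _ x₁≢x₂ _) (γω≡ sub) =
  expand-γω≡ x₁∉M x₁≢x₂ (wf⇒AllLin wM _) sub

mainTheorem17 : (∀ {x M N R Γ σ} → WF ((ƛ x ⇒ M) · N) → Subst M N x R →
                   Γ ⊢ R ∶ σ → Typeable N → Γ ⊢ (ƛ x ⇒ M) · N ∶ σ)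
                × (∀ {M M' Γ σ} → WF M → NonBeta M M' →
                   Γ ⊢ M' ∶ σ → Γ ⊢ M ∶ σ)
mainTheorem17 = subject-expansion-β , subject-expansion-nonβ
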